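{- For every integer $n\ge2$, \[ CP_{(3,0)}(n)=\frac{1+q^{2n-3}+q^{2n-2}}{(1-q^{2n-1})(1-q^{2n})}CP_{(3,0)}(n-1)-\frac{q^{4n-7}}{(1-q^{2n-3})(1-q^{2n-2})(1-q^{2n-1})(1-q^{2n})}CP_{(3,0)}(n-2). \]
   Context: A cylindric partition with profile $(c_1,c_2)$ is a pair of partitions $(\lambda^{(1)},\lambda^{(2)})$ (parts in weakly decreasing order, $\lambda^{(i)}_j=0$ beyond the number of parts) with $\lambda^{(1)}_j\ge\lambda^{(2)}_{j+c_2}$ and $\lambda^{(2)}_j\ge\lambda^{(1)}_{j+c_1}$ for all $j\ge1$; its size is $|\lambda^{(1)}|+|\lambda^{(2)}|$. $CP_{(3,0)}(n)$ is the generating function $\sum q^{\text{size}}$ over cylindric partitions of profile $(3,0)$ in which each partition has at most $n$ parts, with $CP_{(3,0)}(0)=1$. -}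

module Defs where

open import Data.Nat using (ℕ; zero; suc; _+_; _*_; _∸_; _≤ᵇ_; _≡ᵇ_)
open import Data.Bool using (Bool; true; false; _∧_; _∨_; if_then_else_)
open import Data.List using (List; []; _∷_; map; concatMap; upTo)
open import Data.Vec using (Vec; []; _∷_)
open import Data.Integer using (ℤ; +_) renaming (_+_ to _+ℤ_; _-_ to _-ℤ_; _*_ to _*ℤ_)
open import Data.Product using (_×_; _,_)
open import Relation.Binary.PropositionalEquality using (_≡_)

allB : {A : Set} → (A → Bool) → List A → Bool
allB p []       = true
allB p (x ∷ xs) = p x ∧ allB p xs

anyB : {A : Set} → (A → Bool) → List A → Bool
anyB p []       = false
anyB p (x ∷ xs) = p x ∨ anyB p xs

countB : {A : Set} → (A → Bool) → List A → ℕ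
countB p []       = 0
countB p (x ∷ xs) = (if p x then 1 else 0) + countB p xs

-- Partitions with at most n parts, padded by zeros: a vector of length n.
-- at v j = λ_j (1-indexed), = 0 beyond the n stored entries (and for j = 0,
-- which is never used).

at : {n : ℕ} → Vec ℕ n → ℕ → ℕ
at []       _             = 0
at (x ∷ v)  zero          = 0
at (x ∷ v)  (suc zero)    = x
at (x ∷ v)  (suc (suc j)) = at v (suc j)

vsum : {n : ℕ} → Vec ℕ n → ℕ
vsum []      = 0
vsum (x ∷ v) = x + vsum v

decreasing : {n : ℕ} → Vec ℕ n → Bool
decreasing []           = true
decreasing (x ∷ [])     = true
decreasing (x ∷ y ∷ v)  = (y ≤ᵇ x) ∧ decreasing (y ∷ v)

vecs : (n b : ℕ) → List (Vec ℕ n)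
vecs zero    b = [] ∷ []
vecs (suc n) b = concatMap (λ x → map (x ∷_) (vecs n b)) (upTo (suc b))

-- Cylindric partitions of profile (c₁,c₂) = (3,0):
--   λ¹_j ≥ λ²_{j+c₂} = λ²_j   and   λ²_j ≥ λ¹_{j+c₁} = λ¹_{j+3}   for all j ≥ 1.
-- Both sides vanish for j > n, so checking 1 ≤ j ≤ n suffices.

isCP30 : {n : ℕ} → Vec ℕ n × Vec ℕ n → Bool
isCP30 {n} (l1 , l2) =
  decreasing l1 ∧ decreasing l2 ∧
  allB (λ j → (at l2 (suc j + 0) ≤ᵇ at l1 (suc j)) ∧ (at l1 (suc j + 3) ≤ᵇ at l2 (suc j))) (upTo n)

size : {n : ℕ} → Vec ℕ n × Vec ℕ n → ℕ
size (l1 , l2) = vsum l1 + vsum l2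

pairs : (n b : ℕ) → List (Vec ℕ n × Vec ℕ n)
pairs n b = concatMap (λ u → map (u ,_) (vecs n b)) (vecs n b)

-- number of cylindric partitions of profile (3,0), each partition having
-- at most n parts, of size m (all parts are ≤ m, so enumeration up to m is complete)
cpCount : (n m : ℕ) → ℕ
cpCount n m = countB (λ p → isCP30 p ∧ (size p ≡ᵇ m)) (pairs n m)

FPS : Set
FPS = ℕ → ℤ

CP30 : ℕ → FPS
CP30 n m = + cpCount n m

_⊕_ : FPS → FPS → FPS
(f ⊕ g) m = f m +ℤ g m

_⊖_ : FPS → FPS → FPS
(f ⊖ g) m = f m -ℤ g m

Σ≤ : ℕ → (ℕ → ℤ) → ℤ
Σ≤ zero    h = h 0
Σ≤ (suc m) h = Σ≤ m h +ℤ h (suc m)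

_⊛_ : FPS → FPS → FPS
(f ⊛ g) m = Σ≤ m (λ i → f i *ℤ g (m ∸ i))

one : FPS
one zero    = + 1
one (suc _) = + 0

qpow : ℕ → FPS
qpow k m = if k ≡ᵇ m then + 1 else + 0

-- 1/(1 - q^k) = Σ_{j ≥ 0} q^{k j}   (used only for k ≥ 1)
geomInv : ℕ → FPS
geomInv k m = if anyB (λ j → k * j ≡ᵇ m) (upTo (suc m)) then + 1 else + 0

-- Let G(γ, δ) count cylindric partitions of profile (3,0) whose partitions have fewer
-- than γ resp. δ parts. Splitting off the pairs whose partitions have exactly α resp. β
-- parts, and removing the first column of those (which keeps the cylindric conditions
-- when β ≤ α ≤ β + 3), gives the functional equation
--   (1 - q^{α+β}) G(α+1, β+1) = G(α, β+1) + G(α+1, β) - G(α, β).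
-- Interlacing makes some bounds redundant: G(γ, γ+1) = G(γ, γ) and G(δ+4, δ) = G(δ+3, δ).
-- Seven instances of the equation around γ = δ = n + 1 then eliminate every mixed term
-- and express (1 - q^{2n-3}) ⋯ (1 - q^{2n}) CP(n) through CP(n-1) and CP(n-2). Dividing
-- by these factors is legitimate since multiplication by 1 - q^a is injective on power
-- series.
module Submission where

open import Defs
open import Data.Bool using (Bool; true; false; _∧_; if_then_else_; T)
open import Data.Bool.Properties using (T-∧; T-∨; ∧-zeroʳ)
open import Data.List using (List; []; _∷_; _++_; map; concatMap; applyUpTo; upTo)
open import Data.Nat
  using (ℕ; zero; suc; _+_; _*_; _∸_; _≤_; _<_; z≤n; s≤s; z<s; s≤s⁻¹; >-nonZero; _≤ᵇ_; _≡ᵇ_; _<ᵇ_; _<?_)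
open import Data.Nat.Properties
open import Data.Nat.Induction using (<-rec)
open import Data.Nat.Divisibility using (_∣_; divides; _∣?_; _∣0; ∣-refl; ∣⇒≤; ∣m∣n⇒∣m+n; ∣m+n∣m⇒∣n)
open import Data.Nat.Tactic.RingSolver using (solve-∀)
open import Algebra.Properties.CommutativeSemigroup +-commutativeSemigroup using (x∙yz≈y∙xz)
open import Algebra.Structures using (IsCommutativeMonoid)
open import Algebra.Bundles using (CommutativeSemigroup)
open import Level using (0ℓ)
open import Data.Integer using (ℤ; +_; -[1+_]; +0; -_)
  renaming (_+_ to _+ℤ_; _-_ to _-ℤ_; _*_ to _*ℤ_)
import Data.Integer.Properties as ℤ
import Data.Integer.Tactic.RingSolver as ℤ-Solver
open import Data.Product using (_×_; _,_; proj₁; proj₂; ∃)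
open import Data.Sum using (inj₁; inj₂)
open import Data.List.Relation.Unary.All using (All; []; _∷_)
open import Data.List.Relation.Binary.Permutation.Propositional as ↭ using (_↭_; ↭-sym)
open import Data.List.Relation.Binary.Permutation.Propositional.Properties using (↭-reverse)
open import Data.Unit using (tt)
open import Data.Empty using (⊥-elim)
open import Data.Vec using (Vec; []; _∷_; _∷ʳ_)
open import Function using (_∘_; id; flip; _⇔_; mk⇔; Equivalence; case_of_)
open import Function.Construct.Composition using (_⇔-∘_)
open import Function.Construct.Symmetry using (⇔-sym)
open import Relation.Binary.PropositionalEquality
import Relation.Binary.Reasoning.Setoid as SetoidReasoning
open import Relation.Nullary using (¬_; yes; no)

module FiniteSums {A : Set} {_∙_ : A → A → A} {ε : A} (isCommutativeMonoid : IsCommutativeMonoid _≡_ _∙_ ε) where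

  open IsCommutativeMonoid isCommutativeMonoid using (assoc; identityˡ; identityʳ; isCommutativeSemigroup)

  private
    commutativeSemigroup : CommutativeSemigroup 0ℓ 0ℓ
    commutativeSemigroup = record { isCommutativeSemigroup = isCommutativeSemigroup }

  open import Algebra.Properties.CommutativeSemigroup commutativeSemigroup using (interchange)

  sum< : ℕ → (ℕ → A) → A
  sum< zero    f = ε
  sum< (suc c) f = f 0 ∙ sum< c (f ∘ suc)

  sum<-cong : ∀ c {f g} → (∀ x → x < c → f x ≡ g x) → sum< c f ≡ sum< c g
  sum<-cong zero    f≡g = refl
  sum<-cong (suc c) f≡g = cong₂ _∙_ (f≡g 0 z<s) (sum<-cong c (λ x x<c → f≡g (suc x) (s≤s x<c)))

  sum<-zero : ∀ c {f} → (∀ x → x < c → f x ≡ ε) → sum< c f ≡ ε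
  sum<-zero zero    f≡ε = refl
  sum<-zero (suc c) f≡ε = trans (cong₂ _∙_ (f≡ε 0 z<s) (sum<-zero c (λ x x<c → f≡ε (suc x) (s≤s x<c)))) (identityˡ ε)

  sum<-∙ : ∀ c f g → sum< c (λ x → f x ∙ g x) ≡ sum< c f ∙ sum< c g
  sum<-∙ zero    f g = sym (identityˡ ε)
  sum<-∙ (suc c) f g = trans (cong ((f 0 ∙ g 0) ∙_) (sum<-∙ c (f ∘ suc) (g ∘ suc))) (interchange (f 0) (g 0) _ _)

  sum<-truncate : ∀ c m {f} → m ≤ c → (∀ x → m ≤ x → f x ≡ ε) → sum< c f ≡ sum< m f
  sum<-truncate c       zero    _         f≡ε = sum<-zero c (λ x _ → f≡ε x z≤n)
  sum<-truncate (suc c) (suc m) (s≤s m≤c) f≡ε =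
    cong (_ ∙_) (sum<-truncate c m m≤c (λ x m≤x → f≡ε (suc x) (s≤s m≤x)))

  sum<-head : ∀ c f → (∀ x → f (suc x) ≡ ε) → sum< (suc c) f ≡ f 0
  sum<-head c f f≡ε = trans (cong (_ ∙_) (sum<-zero c (λ x _ → f≡ε x))) (identityʳ _)

  sum<-single : ∀ n c {f} → c < n → (∀ x → x < n → x ≢ c → f x ≡ ε) → sum< n f ≡ f c
  sum<-single (suc n) zero    {f} _         f≡ε =
    trans (cong (_ ∙_) (sum<-zero n (λ x x<n → f≡ε (suc x) (s≤s x<n) (λ ())))) (identityʳ _)
  sum<-single (suc n) (suc c) {f} (s≤s c<n) f≡ε = trans
    (cong₂ _∙_ (f≡ε 0 z<s (λ ())) (sum<-single n c c<n (λ x x<n x≢c → f≡ε (suc x) (s≤s x<n) (x≢c ∘ suc-injective))))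
    (identityˡ _)

  sum<-split : ∀ a b f → sum< (a + b) f ≡ sum< a f ∙ sum< b (λ x → f (a + x))
  sum<-split zero    b f = sym (identityˡ _)
  sum<-split (suc a) b f = trans (cong (f 0 ∙_) (sum<-split a b (f ∘ suc))) (sym (assoc (f 0) _ _))

  sum<-snoc : ∀ c f → sum< (suc c) f ≡ sum< c f ∙ f c
  sum<-snoc zero    f = trans (identityʳ (f 0)) (sym (identityˡ (f 0)))
  sum<-snoc (suc c) f = trans (cong (f 0 ∙_) (sum<-snoc c (f ∘ suc))) (sym (assoc (f 0) _ _))

open FiniteSums +-0-isCommutativeMonoid

𝟙 : Bool → ℕ
𝟙 false = 0
𝟙 true  = 1

T-injective : ∀ {b c} → (T b ⇔ T c) → b ≡ c
T-injective {false} {false} _   = refl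
T-injective {false} {true}  b⇔c = ⊥-elim (Equivalence.from b⇔c tt)
T-injective {true}  {false} b⇔c = ⊥-elim (Equivalence.to b⇔c tt)
T-injective {true}  {true}  _   = refl

T-both : ∀ {b c} → T b → T c → b ≡ c
T-both tb tc = T-injective (mk⇔ (λ _ → tc) (λ _ → tb))

𝟙-true : ∀ {b} → T b → 𝟙 b ≡ 1
𝟙-true {true} _ = refl

𝟙-*-cong : ∀ b {x y} → (T b → x ≡ y) → 𝟙 b * x ≡ 𝟙 b * y
𝟙-*-cong false _   = refl
𝟙-*-cong true  x≡y = cong (_+ 0) (x≡y tt)

*-𝟙-cong : ∀ b {x y} → (T b → x ≡ y) → x * 𝟙 b ≡ y * 𝟙 b
*-𝟙-cong false {x} {y} _   = trans (*-zeroʳ x) (sym (*-zeroʳ y))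
*-𝟙-cong true          x≡y = cong (_* 1) (x≡y tt)

*-≡0 : ∀ w {x} → x ≡ 0 → w * x ≡ 0
*-≡0 w x≡0 = trans (cong (w *_) x≡0) (*-zeroʳ w)

if-T : ∀ {A : Set} b {x y : A} → T b → (if b then x else y) ≡ x
if-T true _ = refl

if-¬T : ∀ {A : Set} b {x y : A} → ¬ T b → (if b then x else y) ≡ y
if-¬T false _  = refl
if-¬T true  ¬t = ⊥-elim (¬t tt)

T-allB-applyUpTo : ∀ (p : ℕ → Bool) g c → T (allB p (applyUpTo g c)) ⇔ (∀ j → j < c → T (p (g j)))
T-allB-applyUpTo p g zero    = mk⇔ (λ _ j ()) (λ _ → tt)
T-allB-applyUpTo p g (suc c) = mk⇔
  (λ all → let (head , rest) = Equivalence.to T-∧ all in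
    λ { zero _ → head ; (suc j) (s≤s j<c) → Equivalence.to (T-allB-applyUpTo p (g ∘ suc) c) rest j j<c })
  (λ all → Equivalence.from T-∧
    (all 0 z<s , Equivalence.from (T-allB-applyUpTo p (g ∘ suc) c) (λ j j<c → all (suc j) (s≤s j<c))))

T-anyB-applyUpTo : ∀ (p : ℕ → Bool) g c → T (anyB p (applyUpTo g c)) ⇔ ∃ λ j → j < c × T (p (g j))
T-anyB-applyUpTo p g zero    = mk⇔ (λ ()) (λ { (_ , () , _) })
T-anyB-applyUpTo p g (suc c) = mk⇔
  (λ any → case Equivalence.to (T-∨ {p (g 0)}) any of λ where
    (inj₁ here) → 0 , z<s , here
    (inj₂ there) → let (j , j<c , pj) = Equivalence.to (T-anyB-applyUpTo p (g ∘ suc) c) there in suc j , s≤s j<c , pj)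
  (λ where
    (zero  , _         , pj) → Equivalence.from T-∨ (inj₁ pj)
    (suc j , s≤s j<c , pj) →
      Equivalence.from (T-∨ {p (g 0)}) (inj₂ (Equivalence.from (T-anyB-applyUpTo p (g ∘ suc) c) (j , j<c , pj))))

sum<-* : ∀ c k f → sum< c (λ x → k * f x) ≡ k * sum< c f
sum<-* zero    k f = sym (*-zeroʳ k)
sum<-* (suc c) k f = trans (cong (_+_ (k * f 0)) (sum<-* c k (f ∘ suc))) (sym (*-distribˡ-+ k (f 0) _))

cube : (n b : ℕ) → (Vec ℕ n → ℕ) → ℕ
cube zero    b w = w []
cube (suc n) b w = sum< (suc b) (λ x → cube n b (w ∘ (x ∷_)))

cube² : (n b : ℕ) → (Vec ℕ n → Vec ℕ n → ℕ) → ℕ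
cube² n b W = cube n b (λ u → cube n b (W u))

cube-cong : ∀ n b {w w′} → (∀ u → w u ≡ w′ u) → cube n b w ≡ cube n b w′
cube-cong zero    b w≡w′ = w≡w′ []
cube-cong (suc n) b w≡w′ = sum<-cong (suc b) (λ x _ → cube-cong n b (w≡w′ ∘ (x ∷_)))

cube-zero : ∀ n b {w} → (∀ u → w u ≡ 0) → cube n b w ≡ 0
cube-zero zero    b w≡0 = w≡0 []
cube-zero (suc n) b w≡0 = sum<-zero (suc b) (λ x _ → cube-zero n b (w≡0 ∘ (x ∷_)))

cube-+ : ∀ n b w w′ → cube n b (λ u → w u + w′ u) ≡ cube n b w + cube n b w′
cube-+ zero    b w w′ = refl
cube-+ (suc n) b w w′ = trans (sum<-cong (suc b) (λ x _ → cube-+ n b (w ∘ (x ∷_)) (w′ ∘ (x ∷_))))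
                              (sum<-∙ (suc b) (λ x → cube n b (w ∘ (x ∷_))) (λ x → cube n b (w′ ∘ (x ∷_))))

cube-* : ∀ n b k w → cube n b (λ u → k * w u) ≡ k * cube n b w
cube-* zero    b k w = refl
cube-* (suc n) b k w = trans (sum<-cong (suc b) (λ x _ → cube-* n b k (w ∘ (x ∷_))))
                             (sum<-* (suc b) k (λ x → cube n b (w ∘ (x ∷_))))

cube-bound : ∀ n m b b′ {w} → m ≤ b → m ≤ b′ → (∀ u → m < vsum u → w u ≡ 0) → cube n b w ≡ cube n b′ w
cube-bound zero    m b b′         m≤b m≤b′ w≡0 = refl
cube-bound (suc n) m b b′ {w} m≤b m≤b′ w≡0 = begin
  sum< (suc b) (slice b)   ≡⟨ sum<-truncate (suc b) (suc m) (s≤s m≤b) (λ x → slice-zero b) ⟩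
  sum< (suc m) (slice b)   ≡⟨ sum<-cong (suc m) (λ x x≤m → cube-bound n (m ∸ x) b b′
                                (≤-trans (m∸n≤m m x) m≤b) (≤-trans (m∸n≤m m x) m≤b′) (tail-zero (s≤s⁻¹ x≤m))) ⟩
  sum< (suc m) (slice b′)  ≡⟨ sum<-truncate (suc b′) (suc m) (s≤s m≤b′) (λ x → slice-zero b′) ⟨
  sum< (suc b′) (slice b′) ∎
  where
  open ≡-Reasoning
  slice : ℕ → ℕ → ℕ
  slice c x = cube n c (w ∘ (x ∷_))
  slice-zero : ∀ c {x} → m < x → slice c x ≡ 0
  slice-zero c {x} m<x = cube-zero n c (λ u → w≡0 (x ∷ u) (<-≤-trans m<x (m≤m+n x (vsum u))))
  tail-zero : ∀ {x} → x ≤ m → ∀ u → m ∸ x < vsum u → w (x ∷ u) ≡ 0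
  tail-zero {x} x≤m u lt = w≡0 (x ∷ u) (subst (_< x + vsum u) (m+[n∸m]≡n x≤m) (+-monoʳ-< x lt))

cube-∷ʳ : ∀ n b w → cube (suc n) b w ≡ cube n b (λ u → sum< (suc b) (λ x → w (u ∷ʳ x)))
cube-∷ʳ zero    b w = refl
cube-∷ʳ (suc n) b w = sum<-cong (suc b) (λ y _ → cube-∷ʳ n b (w ∘ (y ∷_)))

cube²-cong : ∀ n b {W W′ : Vec ℕ n → Vec ℕ n → ℕ} → (∀ u v → W u v ≡ W′ u v) → cube² n b W ≡ cube² n b W′
cube²-cong n b W≡W′ = cube-cong n b (λ u → cube-cong n b (W≡W′ u))

cube²-zero : ∀ n b {W : Vec ℕ n → Vec ℕ n → ℕ} → (∀ u v → W u v ≡ 0) → cube² n b W ≡ 0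
cube²-zero n b W≡0 = cube-zero n b (λ u → cube-zero n b (W≡0 u))

cube²-+ : ∀ n b (W W′ : Vec ℕ n → Vec ℕ n → ℕ) →
          cube² n b (λ u v → W u v + W′ u v) ≡ cube² n b W + cube² n b W′
cube²-+ n b W W′ = trans (cube-cong n b (λ u → cube-+ n b (W u) (W′ u))) (cube-+ n b _ _)

cube²-bound : ∀ n m b b′ {W : Vec ℕ n → Vec ℕ n → ℕ} → m ≤ b → m ≤ b′ →
              (∀ u v → m < vsum u + vsum v → W u v ≡ 0) → cube² n b W ≡ cube² n b′ W
cube²-bound n m b b′ m≤b m≤b′ W≡0 = trans
  (cube-cong n b (λ u → cube-bound n m b b′ m≤b m≤b′ (λ v m<v → W≡0 u v (<-≤-trans m<v (m≤n+m _ (vsum u))))))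
  (cube-bound n m b b′ m≤b m≤b′ (λ u m<u → cube-zero n b′ (λ v → W≡0 u v (<-≤-trans m<u (m≤m+n (vsum u) _)))))

Σ-list : {A : Set} → (A → ℕ) → List A → ℕ
Σ-list f []       = 0
Σ-list f (x ∷ xs) = f x + Σ-list f xs

countB-Σ-list : {A : Set} (p : A → Bool) (xs : List A) → countB p xs ≡ Σ-list (𝟙 ∘ p) xs
countB-Σ-list p []       = refl
countB-Σ-list p (x ∷ xs) = cong₂ _+_ (if-𝟙 (p x)) (countB-Σ-list p xs)
  where
  if-𝟙 : ∀ b → (if b then 1 else 0) ≡ 𝟙 b
  if-𝟙 false = refl
  if-𝟙 true  = refl

Σ-list-++ : {A : Set} (f : A → ℕ) (xs ys : List A) → Σ-list f (xs ++ ys) ≡ Σ-list f xs + Σ-list f ys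
Σ-list-++ f []       ys = refl
Σ-list-++ f (x ∷ xs) ys = trans (cong (_+_ (f x)) (Σ-list-++ f xs ys)) (sym (+-assoc (f x) _ _))

Σ-list-concatMap-map : {A B C : Set} (f : C → ℕ) (g : A → B → C) (ys : List B) (xs : List A) →
                       Σ-list f (concatMap (λ x → map (g x) ys) xs) ≡ Σ-list (λ x → Σ-list (f ∘ g x) ys) xs
Σ-list-concatMap-map f g ys []       = refl
Σ-list-concatMap-map f g ys (x ∷ xs) = begin
  Σ-list f (map (g x) ys ++ concatMap (λ x → map (g x) ys) xs)
    ≡⟨ Σ-list-++ f (map (g x) ys) _ ⟩
  Σ-list f (map (g x) ys) + Σ-list f (concatMap (λ x → map (g x) ys) xs)
    ≡⟨ cong₂ _+_ (Σ-list-map ys) (Σ-list-concatMap-map f g ys xs) ⟩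
  Σ-list (f ∘ g x) ys + Σ-list (λ x → Σ-list (f ∘ g x) ys) xs ∎
  where
  open ≡-Reasoning
  Σ-list-map : ∀ ys → Σ-list f (map (g x) ys) ≡ Σ-list (f ∘ g x) ys
  Σ-list-map []       = refl
  Σ-list-map (y ∷ ys) = cong (_+_ (f (g x y))) (Σ-list-map ys)

Σ-list-applyUpTo : ∀ (f g : ℕ → ℕ) c → Σ-list f (applyUpTo g c) ≡ sum< c (f ∘ g)
Σ-list-applyUpTo f g zero    = refl
Σ-list-applyUpTo f g (suc c) = cong (_+_ (f (g 0))) (Σ-list-applyUpTo f (g ∘ suc) c)

Σ-list-vecs : ∀ n b (w : Vec ℕ n → ℕ) → Σ-list w (vecs n b) ≡ cube n b w
Σ-list-vecs zero    b w = +-identityʳ (w [])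
Σ-list-vecs (suc n) b w = begin
  Σ-list w (concatMap (λ x → map (x ∷_) (vecs n b)) (upTo (suc b)))
    ≡⟨ Σ-list-concatMap-map w _∷_ (vecs n b) (upTo (suc b)) ⟩
  Σ-list (λ x → Σ-list (w ∘ (x ∷_)) (vecs n b)) (upTo (suc b))
    ≡⟨ Σ-list-applyUpTo _ id (suc b) ⟩
  sum< (suc b) (λ x → Σ-list (w ∘ (x ∷_)) (vecs n b))
    ≡⟨ sum<-cong (suc b) (λ x _ → Σ-list-vecs n b (w ∘ (x ∷_))) ⟩
  cube (suc n) b w ∎
  where open ≡-Reasoning

countB-pairs : ∀ n b (p : Vec ℕ n × Vec ℕ n → Bool) →
               countB p (pairs n b) ≡ cube² n b (λ u v → 𝟙 (p (u , v)))
countB-pairs n b p = begin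
  countB p (pairs n b)
    ≡⟨ countB-Σ-list p (pairs n b) ⟩
  Σ-list (𝟙 ∘ p) (concatMap (λ u → map (u ,_) (vecs n b)) (vecs n b))
    ≡⟨ Σ-list-concatMap-map (𝟙 ∘ p) _,_ (vecs n b) (vecs n b) ⟩
  Σ-list (λ u → Σ-list (λ v → 𝟙 (p (u , v))) (vecs n b)) (vecs n b)
    ≡⟨ Σ-list-vecs n b _ ⟩
  cube n b (λ u → Σ-list (λ v → 𝟙 (p (u , v))) (vecs n b))
    ≡⟨ cube-cong n b (λ u → Σ-list-vecs n b _) ⟩
  cube² n b (λ u v → 𝟙 (p (u , v))) ∎
  where open ≡-Reasoning

-- Padded partitions and the cylindric conditions

at-beyond : ∀ {n} (u : Vec ℕ n) j → n ≤ j → at u (suc j) ≡ 0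
at-beyond []      j       _         = refl
at-beyond (x ∷ u) (suc j) (s≤s n≤j) = at-beyond u j n≤j

VanishesFrom : ℕ → (ℕ → ℕ) → Set
VanishesFrom α f = ∀ j → α ≤ j → f (suc j) ≡ 0

VanishesFrom-mono : ∀ {α β f} → α ≤ β → VanishesFrom α f → VanishesFrom β f
VanishesFrom-mono α≤β vanish j β≤j = vanish j (≤-trans α≤β β≤j)

Decreasing : (ℕ → ℕ) → Set
Decreasing f = ∀ j → f (suc (suc j)) ≤ f (suc j)

decreasing⇔ : ∀ {n} (u : Vec ℕ n) → T (decreasing u) ⇔ Decreasing (at u)
decreasing⇔ u = mk⇔ (to u) (from u)
  where
  to : ∀ {n} (u : Vec ℕ n) → T (decreasing u) → Decreasing (at u)
  to []          _ j       = z≤n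
  to (x ∷ [])    _ j       = z≤n
  to (x ∷ y ∷ v) t zero    = ≤ᵇ⇒≤ y x (proj₁ (Equivalence.to T-∧ t))
  to (x ∷ y ∷ v) t (suc j) = to (y ∷ v) (proj₂ (Equivalence.to T-∧ t)) j
  from : ∀ {n} (u : Vec ℕ n) → Decreasing (at u) → T (decreasing u)
  from []          _   = tt
  from (x ∷ [])    _   = tt
  from (x ∷ y ∷ v) dec = Equivalence.from T-∧ (≤⇒≤ᵇ (dec 0) , from (y ∷ v) (dec ∘ suc))

decreasing-tail : ∀ {n} x (u : Vec ℕ n) → T (decreasing (x ∷ u)) → T (decreasing u)
decreasing-tail x []      _ = tt
decreasing-tail x (y ∷ u) d = proj₂ (Equivalence.to T-∧ d)

record Cylindric30 (f g : ℕ → ℕ) : Set where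
  field
    decreasing₁ : Decreasing f
    decreasing₂ : Decreasing g
    interlace₁  : ∀ j → g (suc j) ≤ f (suc j)
    interlace₂  : ∀ j → f (suc j + 3) ≤ g (suc j)
open Cylindric30

isCP30⇔ : ∀ {n} (u v : Vec ℕ n) → T (isCP30 (u , v)) ⇔ Cylindric30 (at u) (at v)
isCP30⇔ {n} u v = mk⇔ to from
  where
  condition : ℕ → Bool
  condition j = (at v (suc j + 0) ≤ᵇ at u (suc j)) ∧ (at u (suc j + 3) ≤ᵇ at v (suc j))
  condition⇔ : T (allB condition (upTo n)) ⇔ (∀ j → j < n → T (condition j))
  condition⇔ = T-allB-applyUpTo condition id n
  at-suc-+0 : ∀ j → at v (suc j + 0) ≡ at v (suc j)
  at-suc-+0 j = cong (at v ∘ suc) (+-identityʳ j)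
  to : T (isCP30 (u , v)) → Cylindric30 (at u) (at v)
  to t with Equivalence.to (T-∧ {decreasing u}) t
  ... | dec₁ , t′ with Equivalence.to (T-∧ {decreasing v}) t′
  ... | dec₂ , conditions = record
    { decreasing₁ = Equivalence.to (decreasing⇔ u) dec₁
    ; decreasing₂ = Equivalence.to (decreasing⇔ v) dec₂
    ; interlace₁  = λ j → case j <? n of λ where
        (yes j<n) → subst (_≤ at u (suc j)) (at-suc-+0 j) (≤ᵇ⇒≤ _ _ (proj₁ (condition-at j<n)))
        (no j≮n)  → subst (_≤ at u (suc j)) (sym (at-beyond v j (≮⇒≥ j≮n))) z≤n
    ; interlace₂  = λ j → case j <? n of λ where
        (yes j<n) → ≤ᵇ⇒≤ _ _ (proj₂ (condition-at j<n))
        (no j≮n)  → subst (_≤ at v (suc j)) (sym (at-beyond u (j + 3) (≤-trans (≮⇒≥ j≮n) (m≤m+n j 3)))) z≤n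
    }
    where
    condition-at : ∀ {j} → j < n → T (at v (suc j + 0) ≤ᵇ at u (suc j)) × T (at u (suc j + 3) ≤ᵇ at v (suc j))
    condition-at {j} j<n = Equivalence.to T-∧ (Equivalence.to condition⇔ conditions j j<n)
  from : Cylindric30 (at u) (at v) → T (isCP30 (u , v))
  from c = Equivalence.from T-∧ (Equivalence.from (decreasing⇔ u) (decreasing₁ c) , Equivalence.from T-∧
    (Equivalence.from (decreasing⇔ v) (decreasing₂ c) , Equivalence.from condition⇔ (λ j _ → Equivalence.from T-∧
      (≤⇒≤ᵇ (subst (_≤ at u (suc j)) (sym (at-suc-+0 j)) (interlace₁ c j)) , ≤⇒≤ᵇ (interlace₂ c j)))))

Cylindric30-⇔ : ∀ {f g f′ g′} →
                (∀ j → f (suc (suc j)) ≤ f (suc j) ⇔ f′ (suc (suc j)) ≤ f′ (suc j)) →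
                (∀ j → g (suc (suc j)) ≤ g (suc j) ⇔ g′ (suc (suc j)) ≤ g′ (suc j)) →
                (∀ j → g (suc j) ≤ f (suc j) ⇔ g′ (suc j) ≤ f′ (suc j)) →
                (∀ j → f (suc j + 3) ≤ g (suc j) ⇔ f′ (suc j + 3) ≤ g′ (suc j)) →
                Cylindric30 f g ⇔ Cylindric30 f′ g′
Cylindric30-⇔ dec₁ dec₂ int₁ int₂ = mk⇔
  (λ c → record
    { decreasing₁ = λ j → Equivalence.to (dec₁ j) (decreasing₁ c j)
    ; decreasing₂ = λ j → Equivalence.to (dec₂ j) (decreasing₂ c j)
    ; interlace₁  = λ j → Equivalence.to (int₁ j) (interlace₁ c j)
    ; interlace₂  = λ j → Equivalence.to (int₂ j) (interlace₂ c j) })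
  (λ c → record
    { decreasing₁ = λ j → Equivalence.from (dec₁ j) (decreasing₁ c j)
    ; decreasing₂ = λ j → Equivalence.from (dec₂ j) (decreasing₂ c j)
    ; interlace₁  = λ j → Equivalence.from (int₁ j) (interlace₁ c j)
    ; interlace₂  = λ j → Equivalence.from (int₂ j) (interlace₂ c j) })

isCP30-cong : ∀ {n n′} (u v : Vec ℕ n) (u′ v′ : Vec ℕ n′) → at u ≗ at u′ → at v ≗ at v′ →
              isCP30 (u , v) ≡ isCP30 (u′ , v′)
isCP30-cong u v u′ v′ u≗u′ v≗v′ = T-injective (⇔-sym (isCP30⇔ u′ v′) ⇔-∘
  (Cylindric30-⇔ (λ j → ≤-⇔ (u≗u′ _) (u≗u′ _)) (λ j → ≤-⇔ (v≗v′ _) (v≗v′ _))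
                 (λ j → ≤-⇔ (v≗v′ _) (u≗u′ _)) (λ j → ≤-⇔ (u≗u′ _) (v≗v′ _)) ⇔-∘ isCP30⇔ u v))
  where
  ≤-⇔ : ∀ {a b a′ b′} → a ≡ a′ → b ≡ b′ → (a ≤ b ⇔ a′ ≤ b′)
  ≤-⇔ refl refl = mk⇔ id id

isCP30-decreasing : ∀ {n} (u v : Vec ℕ n) → T (isCP30 (u , v)) → T (decreasing u) × T (decreasing v)
isCP30-decreasing u v t with Equivalence.to (T-∧ {decreasing u}) t
... | dec₁ , t′ = dec₁ , proj₁ (Equivalence.to (T-∧ {decreasing v}) t′)

Cylindric30-vanishes₂ : ∀ {f g} α → Cylindric30 f g → VanishesFrom α f → VanishesFrom α g
Cylindric30-vanishes₂ α c vanish j α≤j = n≤0⇒n≡0 (subst (_ ≤_) (vanish j α≤j) (interlace₁ c j))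

Cylindric30-vanishes₁ : ∀ {f g} β → Cylindric30 f g → VanishesFrom β g → VanishesFrom (3 + β) f
Cylindric30-vanishes₁ {f} β c vanish j 3+β≤j = n≤0⇒n≡0 (subst₂ _≤_
  (cong (f ∘ suc) (m∸n+n≡m (m+n≤o⇒m≤o 3 3+β≤j)))
  (vanish (j ∸ 3) (m+n≤o⇒m≤o∸n β (subst (_≤ j) (+-comm 3 β) 3+β≤j)))
  (interlace₂ c (j ∸ 3)))

atMostParts : {n : ℕ} → ℕ → Vec ℕ n → Bool
atMostParts α       []      = true
atMostParts zero    (x ∷ u) = (x ≡ᵇ 0) ∧ atMostParts zero u
atMostParts (suc α) (x ∷ u) = atMostParts α u

exactlyParts : {n : ℕ} → ℕ → Vec ℕ n → Bool
exactlyParts zero    u       = atMostParts zero u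
exactlyParts (suc α) []      = false
exactlyParts (suc α) (x ∷ u) = (0 <ᵇ x) ∧ exactlyParts α u

-- fewerParts 0 is the empty condition, standing for "at most -1 parts".
fewerParts : {n : ℕ} → ℕ → Vec ℕ n → Bool
fewerParts zero    u = false
fewerParts (suc α) u = atMostParts α u

atMostParts⇔ : ∀ {n} α (u : Vec ℕ n) → T (atMostParts α u) ⇔ VanishesFrom α (at u)
atMostParts⇔ α u = mk⇔ (to α u) (from α u)
  where
  to : ∀ {n} α (u : Vec ℕ n) → T (atMostParts α u) → VanishesFrom α (at u)
  to α       []      _ j       _         = refl
  to zero    (x ∷ u) t zero    _         = ≡ᵇ⇒≡ x 0 (proj₁ (Equivalence.to T-∧ t))
  to zero    (x ∷ u) t (suc j) _         = to zero u (proj₂ (Equivalence.to T-∧ t)) j z≤n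
  to (suc α) (x ∷ u) t (suc j) (s≤s α≤j) = to α u t j α≤j
  from : ∀ {n} α (u : Vec ℕ n) → VanishesFrom α (at u) → T (atMostParts α u)
  from α       []      _      = tt
  from zero    (x ∷ u) vanish =
    Equivalence.from T-∧ (≡⇒≡ᵇ x 0 (vanish 0 z≤n) , from zero u (λ j _ → vanish (suc j) z≤n))
  from (suc α) (x ∷ u) vanish = from α u (λ j α≤j → vanish (suc j) (s≤s α≤j))

atMostParts-all : ∀ {n} (u : Vec ℕ n) → T (atMostParts n u)
atMostParts-all u = Equivalence.from (atMostParts⇔ _ u) (at-beyond u)

atMostParts-suc : ∀ {n} α (u : Vec ℕ n) → VanishesFrom α (at u) → atMostParts (suc α) u ≡ atMostParts α u
atMostParts-suc α u vanish = T-both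
  (Equivalence.from (atMostParts⇔ (suc α) u) (VanishesFrom-mono {f = at u} (n≤1+n α) vanish))
  (Equivalence.from (atMostParts⇔ α u) vanish)

atMostParts-cong : ∀ {n n′} α (u : Vec ℕ n) (u′ : Vec ℕ n′) → at u ≗ at u′ → atMostParts α u ≡ atMostParts α u′
atMostParts-cong α u u′ u≗u′ = T-injective (mk⇔
  (λ t → Equivalence.from (atMostParts⇔ α u′) (λ j α≤j →
     trans (sym (u≗u′ (suc j))) (Equivalence.to (atMostParts⇔ α u) t j α≤j)))
  (λ t → Equivalence.from (atMostParts⇔ α u) (λ j α≤j →
     trans (u≗u′ (suc j)) (Equivalence.to (atMostParts⇔ α u′) t j α≤j))))

fewerParts-cong : ∀ {n n′} γ (u : Vec ℕ n) (u′ : Vec ℕ n′) → at u ≗ at u′ → fewerParts γ u ≡ fewerParts γ u′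
fewerParts-cong zero    u u′ _    = refl
fewerParts-cong (suc α) u u′ u≗u′ = atMostParts-cong α u u′ u≗u′

𝟙-atMostParts-split : ∀ {n} α (u : Vec ℕ n) → T (decreasing u) →
                      𝟙 (atMostParts α u) ≡ 𝟙 (exactlyParts α u) + 𝟙 (fewerParts α u)
𝟙-atMostParts-split zero          u                  _ = sym (+-identityʳ _)
𝟙-atMostParts-split (suc α)       []                 _ = refl
𝟙-atMostParts-split (suc zero)    (zero ∷ u)         _ = refl
𝟙-atMostParts-split (suc zero)    (suc x ∷ u)        _ = sym (+-identityʳ _)
𝟙-atMostParts-split (suc (suc α)) (suc x ∷ u)        d = 𝟙-atMostParts-split (suc α) u (decreasing-tail (suc x) u d)
𝟙-atMostParts-split (suc (suc α)) (zero ∷ [])        _ = refl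
𝟙-atMostParts-split (suc (suc α)) (zero ∷ zero ∷ u)  d =
  𝟙-atMostParts-split (suc α) (zero ∷ u) (decreasing-tail 0 (0 ∷ u) d)

at-∷ʳ0 : ∀ {n} (u : Vec ℕ n) → at (u ∷ʳ 0) ≗ at u
at-∷ʳ0 []      zero          = refl
at-∷ʳ0 []      (suc zero)    = refl
at-∷ʳ0 []      (suc (suc j)) = refl
at-∷ʳ0 (x ∷ u) zero          = refl
at-∷ʳ0 (x ∷ u) (suc zero)    = refl
at-∷ʳ0 (x ∷ u) (suc (suc j)) = at-∷ʳ0 u (suc j)

at-∷ʳ-last : ∀ {n} (u : Vec ℕ n) x → at (u ∷ʳ x) (suc n) ≡ x
at-∷ʳ-last []      x = refl
at-∷ʳ-last (y ∷ u) x = at-∷ʳ-last u x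

vsum-∷ʳ : ∀ {n} (u : Vec ℕ n) x → vsum (u ∷ʳ x) ≡ vsum u + x
vsum-∷ʳ []      x = +-identityʳ x
vsum-∷ʳ (y ∷ u) x = trans (cong (_+_ y) (vsum-∷ʳ u x)) (sym (+-assoc y _ x))

fewerParts-∷ʳ-positive : ∀ {n} γ (u : Vec ℕ n) x → γ ≤ suc n → fewerParts γ (u ∷ʳ suc x) ≡ false
fewerParts-∷ʳ-positive zero    u x _ = refl
fewerParts-∷ʳ-positive {n} (suc α) u x (s≤s α≤n) = T-injective (mk⇔ last-vanishes λ ())
  where
  last-vanishes : T (atMostParts α (u ∷ʳ suc x)) → T false
  last-vanishes t with () ← trans (sym (at-∷ʳ-last u (suc x))) (Equivalence.to (atMostParts⇔ α (u ∷ʳ suc x)) t n α≤n)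

-- The first-column bijection

raise : {n : ℕ} → ℕ → Vec ℕ n → Vec ℕ n
raise zero    u       = u
raise (suc α) []      = []
raise (suc α) (x ∷ u) = suc x ∷ raise α u

at-raise : ∀ {n} α j (u : Vec ℕ n) → α ≤ n → at (raise α u) (suc j) ≡ 𝟙 (j <ᵇ α) + at u (suc j)
at-raise zero    j       u       _         = refl
at-raise (suc α) zero    (x ∷ u) _         = refl
at-raise (suc α) (suc j) (x ∷ u) (s≤s α≤n) = at-raise α j u α≤n

vsum-raise : ∀ {n} α (u : Vec ℕ n) → α ≤ n → vsum (raise α u) ≡ α + vsum u
vsum-raise zero    u       _         = refl
vsum-raise (suc α) (x ∷ u) (s≤s α≤n) = begin
  suc x + vsum (raise α u) ≡⟨ cong (_+_ (suc x)) (vsum-raise α u α≤n) ⟩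
  suc x + (α + vsum u)     ≡⟨ cong suc (x∙yz≈y∙xz x α (vsum u)) ⟩
  suc α + (x + vsum u)     ∎
  where open ≡-Reasoning

size-raise : ∀ {n} α β (u v : Vec ℕ n) → α ≤ n → β ≤ n → size (raise α u , raise β v) ≡ size (u , v) + (α + β)
size-raise α β u v α≤n β≤n =
  trans (cong₂ _+_ (vsum-raise α u α≤n) (vsum-raise β v β≤n)) (rearrange α β (vsum u) (vsum v))
  where
  rearrange : ∀ α β x y → α + x + (β + y) ≡ x + y + (α + β)
  rearrange = solve-∀

𝟙+-≤-cancel : ∀ {s t} a b → (T s → T t) → (T t → ¬ T s → a ≡ 0) → (𝟙 s + a ≤ 𝟙 t + b ⇔ a ≤ b)
𝟙+-≤-cancel {false} {false} a b _   _    = mk⇔ id id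
𝟙+-≤-cancel {false} {true}  a b _   a≡0  rewrite a≡0 tt id = mk⇔ (λ _ → z≤n) (λ _ → z≤n)
𝟙+-≤-cancel {true}  {false} a b s⇒t _    = ⊥-elim (s⇒t tt)
𝟙+-≤-cancel {true}  {true}  a b _   _    = mk⇔ s≤s⁻¹ s≤s

raise-≤-cancel : ∀ {n n′} α β (u : Vec ℕ n) (v : Vec ℕ n′) i j → α ≤ n → β ≤ n′ →
                 (i < α → j < β) → (j < β → α ≤ i → at u (suc i) ≡ 0) →
                 (at (raise α u) (suc i) ≤ at (raise β v) (suc j) ⇔ at u (suc i) ≤ at v (suc j))
raise-≤-cancel α β u v i j α≤n β≤n′ i<α⇒j<β u-zero
  rewrite at-raise α i u α≤n | at-raise β j v β≤n′ =
  𝟙+-≤-cancel (at u (suc i)) (at v (suc j))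
    (λ i<α → <⇒<ᵇ (i<α⇒j<β (<ᵇ⇒< i α i<α)))
    (λ j<β i≮α → u-zero (<ᵇ⇒< j β j<β) (≮⇒≥ (i≮α ∘ <⇒<ᵇ)))

Cylindric30-raise : ∀ {n} α β (u v : Vec ℕ n) → VanishesFrom α (at u) → VanishesFrom β (at v) →
                    β ≤ α → α ≤ 3 + β → α ≤ n →
                    Cylindric30 (at (raise α u)) (at (raise β v)) ⇔ Cylindric30 (at u) (at v)
Cylindric30-raise α β u v u-zero v-zero β≤α α≤3+β α≤n = Cylindric30-⇔ dec₁ dec₂ int₁ int₂
  where
  β≤n = ≤-trans β≤α α≤n
  dec₁ = λ j → raise-≤-cancel α α u u (suc j) j α≤n α≤n (<-trans (n<1+n j)) (λ _ α≤1+j → u-zero (suc j) α≤1+j)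
  dec₂ = λ j → raise-≤-cancel β β v v (suc j) j β≤n β≤n (<-trans (n<1+n j)) (λ _ β≤1+j → v-zero (suc j) β≤1+j)
  int₁ = λ j → raise-≤-cancel β α v u j j β≤n α≤n (λ j<β → <-≤-trans j<β β≤α) (λ _ β≤j → v-zero j β≤j)
  int₂ = λ j → raise-≤-cancel α β u v (j + 3) j α≤n β≤n
                 (λ j+3<α → +-cancelʳ-< 3 j β (<-≤-trans j+3<α (≤-trans α≤3+β (≤-reflexive (+-comm 3 β)))))
                 (λ _ α≤j+3 → u-zero (j + 3) α≤j+3)

isCP30-raise : ∀ {n} α β (u v : Vec ℕ n) → T (atMostParts α u) → T (atMostParts β v) →
               β ≤ α → α ≤ 3 + β → α ≤ n → isCP30 (raise α u , raise β v) ≡ isCP30 (u , v)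
isCP30-raise α β u v tu tv β≤α α≤3+β α≤n = T-injective
  (⇔-sym (isCP30⇔ u v) ⇔-∘ (Cylindric30-raise α β u v (Equivalence.to (atMostParts⇔ α u) tu)
                              (Equivalence.to (atMostParts⇔ β v) tv) β≤α α≤3+β α≤n
                            ⇔-∘ isCP30⇔ (raise α u) (raise β v)))

cube-exactlyParts : ∀ n b α (w : Vec ℕ n → ℕ) → α ≤ n →
  cube n (suc b) (λ u → 𝟙 (exactlyParts α u) * w u) ≡ cube n b (λ u → 𝟙 (atMostParts α u) * w (raise α u))
cube-exactlyParts zero    b zero    w _         = refl
cube-exactlyParts (suc n) b zero    w _         =
  cong₂ _+_ (cube-exactlyParts n b zero (w ∘ (0 ∷_)) z≤n) (trans (positive-head (suc b) (suc b)) (sym (positive-head b b)))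
  where
  positive-head : ∀ c b′ → sum< c (λ x → cube n b′ (λ u → 𝟙 (atMostParts 0 (suc x ∷ u)) * w (suc x ∷ u))) ≡ 0
  positive-head c b′ = sum<-zero c (λ x _ → cube-zero n b′ (λ u → refl))
cube-exactlyParts (suc n) b (suc α) w (s≤s α≤n) =
  cong₂ _+_ (cube-zero n (suc b) (λ u → refl))
            (sum<-cong (suc b) (λ x _ → cube-exactlyParts n b α (w ∘ (suc x ∷_)) α≤n))

cube²-exactlyParts : ∀ n b α β (W : Vec ℕ n → Vec ℕ n → ℕ) → α ≤ n → β ≤ n →
  cube² n (suc b) (λ u v → 𝟙 (exactlyParts α u) * (𝟙 (exactlyParts β v) * W u v)) ≡
  cube² n b (λ u v → 𝟙 (atMostParts α u) * (𝟙 (atMostParts β v) * W (raise α u) (raise β v)))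
cube²-exactlyParts n b α β W α≤n β≤n = begin
  cube n (suc b) (λ u → cube n (suc b) (λ v → 𝟙 (exactlyParts α u) * (𝟙 (exactlyParts β v) * W u v)))
    ≡⟨ cube-cong n (suc b) (λ u → cube-* n (suc b) (𝟙 (exactlyParts α u)) (λ v → 𝟙 (exactlyParts β v) * W u v)) ⟩
  cube n (suc b) (λ u → 𝟙 (exactlyParts α u) * cube n (suc b) (λ v → 𝟙 (exactlyParts β v) * W u v))
    ≡⟨ cube-cong n (suc b) (λ u → cong (𝟙 (exactlyParts α u) *_) (cube-exactlyParts n b β (W u) β≤n)) ⟩
  cube n (suc b) (λ u → 𝟙 (exactlyParts α u) * cube n b (λ v → 𝟙 (atMostParts β v) * W u (raise β v)))
    ≡⟨ cube-exactlyParts n b α (λ u → cube n b (λ v → 𝟙 (atMostParts β v) * W u (raise β v))) α≤n ⟩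
  cube n b (λ u → 𝟙 (atMostParts α u) * cube n b (λ v → 𝟙 (atMostParts β v) * W (raise α u) (raise β v)))
    ≡⟨ cube-cong n b (λ u →
         cube-* n b (𝟙 (atMostParts α u)) (λ v → 𝟙 (atMostParts β v) * W (raise α u) (raise β v))) ⟨
  cube² n b (λ u v → 𝟙 (atMostParts α u) * (𝟙 (atMostParts β v) * W (raise α u) (raise β v))) ∎
  where open ≡-Reasoning

cpWeight : ∀ {n} → ℕ → Vec ℕ n → Vec ℕ n → ℕ
cpWeight m u v = 𝟙 (isCP30 (u , v) ∧ (size (u , v) ≡ᵇ m))

count : (N γ δ m : ℕ) → ℕ
count N γ δ m = cube² N m (λ u v → cpWeight m u v * (𝟙 (fewerParts γ u) * 𝟙 (fewerParts δ v)))

exactCount : (N α β m : ℕ) → ℕ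
exactCount N α β m = cube² N m (λ u v → cpWeight m u v * (𝟙 (exactlyParts α u) * 𝟙 (exactlyParts β v)))

cpWeight-*-cong : ∀ {n} m (u v : Vec ℕ n) {x y} → (T (isCP30 (u , v)) → x ≡ y) → cpWeight m u v * x ≡ cpWeight m u v * y
cpWeight-*-cong m u v x≡y = 𝟙-*-cong (isCP30 (u , v) ∧ _) (x≡y ∘ proj₁ ∘ Equivalence.to T-∧)

cpWeight-beyond : ∀ {n} m (u v : Vec ℕ n) → m < vsum u + vsum v → cpWeight m u v ≡ 0
cpWeight-beyond m u v m<size with size (u , v) ≡ᵇ m in eq
... | true  = ⊥-elim (<⇒≢ m<size (sym (≡ᵇ⇒≡ _ m (subst T (sym eq) tt))))
... | false = cong 𝟙 (∧-zeroʳ (isCP30 (u , v)))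

cpWeight-raise : ∀ {n} m α β (u v : Vec ℕ n) → T (atMostParts α u) → T (atMostParts β v) →
                 β ≤ α → α ≤ 3 + β → α ≤ n →
                 cpWeight m (raise α u) (raise β v) ≡ 𝟙 (isCP30 (u , v) ∧ (size (u , v) + (α + β) ≡ᵇ m))
cpWeight-raise m α β u v tu tv β≤α α≤3+β α≤n =
  cong₂ (λ cp s → 𝟙 (cp ∧ (s ≡ᵇ m))) (isCP30-raise α β u v tu tv β≤α α≤3+β α≤n)
                                      (size-raise α β u v α≤n (≤-trans β≤α α≤n))

cpCount≡count : ∀ n m → cpCount n m ≡ count n (suc n) (suc n) m
cpCount≡count n m = trans (countB-pairs n m _) (cube²-cong n m (λ u v → sym (begin
  cpWeight m u v * (𝟙 (atMostParts n u) * 𝟙 (atMostParts n v))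
    ≡⟨ cong₂ (λ a b → cpWeight m u v * (a * b)) (𝟙-true (atMostParts-all u)) (𝟙-true (atMostParts-all v)) ⟩
  cpWeight m u v * 1
    ≡⟨ *-identityʳ _ ⟩
  cpWeight m u v ∎)))
  where open ≡-Reasoning

inclusion–exclusion : ∀ e z e′ z′ → (e + z) * (e′ + z′) + z * z′ ≡ e * e′ + z * (e′ + z′) + (e + z) * z′
inclusion–exclusion = solve-∀

*-distribˡ-+³ : ∀ w x y z → w * (x + y + z) ≡ w * x + w * y + w * z
*-distribˡ-+³ = solve-∀

count-split : ∀ N α β m →
  count N (suc α) (suc β) m + count N α β m ≡ exactCount N α β m + count N α (suc β) m + count N (suc α) β m
count-split N α β m = begin
  count N (suc α) (suc β) m + count N α β m
    ≡⟨ cube²-+ N m _ _ ⟨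
  cube² N m (λ u v → cpWeight m u v * (A α u * A β v) + cpWeight m u v * (Z α u * Z β v))
    ≡⟨ cube²-cong N m split ⟩
  cube² N m (λ u v → cpWeight m u v * (E α u * E β v) + cpWeight m u v * (Z α u * A β v) + cpWeight m u v * (A α u * Z β v))
    ≡⟨ cube²-+ N m _ _ ⟩
  cube² N m (λ u v → cpWeight m u v * (E α u * E β v) + cpWeight m u v * (Z α u * A β v)) + count N (suc α) β m
    ≡⟨ cong (_+ count N (suc α) β m) (cube²-+ N m _ _) ⟩
  exactCount N α β m + count N α (suc β) m + count N (suc α) β m ∎
  where
  open ≡-Reasoning
  E Z A : ℕ → Vec ℕ N → ℕ
  E α u = 𝟙 (exactlyParts α u)
  Z α u = 𝟙 (fewerParts α u)
  A α u = 𝟙 (atMostParts α u)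
  split : ∀ u v → cpWeight m u v * (A α u * A β v) + cpWeight m u v * (Z α u * Z β v) ≡
                 cpWeight m u v * (E α u * E β v) + cpWeight m u v * (Z α u * A β v) + cpWeight m u v * (A α u * Z β v)
  split u v = begin
    w * (A α u * A β v) + w * (Z α u * Z β v)
      ≡⟨ *-distribˡ-+ w _ _ ⟨
    w * (A α u * A β v + Z α u * Z β v)
      ≡⟨ cpWeight-*-cong m u v (λ t → let (dec₁ , dec₂) = isCP30-decreasing u v t in
           cong₂ (λ a a′ → a * a′ + Z α u * Z β v)
                 (𝟙-atMostParts-split α u dec₁) (𝟙-atMostParts-split β v dec₂)) ⟩
    w * ((E α u + Z α u) * (E β v + Z β v) + Z α u * Z β v)
      ≡⟨ cong (w *_) (inclusion–exclusion (E α u) (Z α u) (E β v) (Z β v)) ⟩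
    w * (E α u * E β v + Z α u * (E β v + Z β v) + (E α u + Z α u) * Z β v)
      ≡⟨ cpWeight-*-cong m u v (λ t → let (dec₁ , dec₂) = isCP30-decreasing u v t in
           cong₂ (λ a a′ → E α u * E β v + Z α u * a′ + a * Z β v)
                 (𝟙-atMostParts-split α u dec₁) (𝟙-atMostParts-split β v dec₂)) ⟨
    w * (E α u * E β v + Z α u * A β v + A α u * Z β v)
      ≡⟨ *-distribˡ-+³ w _ _ _ ⟩
    w * (E α u * E β v) + w * (Z α u * A β v) + w * (A α u * Z β v) ∎
    where w = cpWeight m u v

+-≡ᵇ-∸ : ∀ s c m → c ≤ m → (s + c ≡ᵇ m) ≡ (s ≡ᵇ m ∸ c)
+-≡ᵇ-∸ s c m c≤m = T-injective (mk⇔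
  (λ t → ≡⇒≡ᵇ s (m ∸ c) (trans (sym (m+n∸n≡m s c)) (cong (_∸ c) (≡ᵇ⇒≡ (s + c) m t))))
  (λ t → ≡⇒≡ᵇ (s + c) m (trans (cong (_+ c) (≡ᵇ⇒≡ s (m ∸ c) t)) (m∸n+n≡m c≤m))))

+-≡ᵇ-< : ∀ s c m → m < c → (s + c ≡ᵇ m) ≡ false
+-≡ᵇ-< s c m m<c = T-injective (mk⇔ (λ t → <⇒≱ m<c (subst (c ≤_) (≡ᵇ⇒≡ (s + c) m t) (m≤n+m c s))) λ ())

exactCount-raised : ∀ N α β m → α ≤ N → β ≤ N →
  exactCount N α β m ≡
  cube² N m (λ u v → 𝟙 (atMostParts α u) * (𝟙 (atMostParts β v) * cpWeight m (raise α u) (raise β v)))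
exactCount-raised N α β m α≤N β≤N = begin
  exactCount N α β m
    ≡⟨ cube²-bound N m m (suc m) ≤-refl (n≤1+n m) (λ u v m<size → cong (_* _) (cpWeight-beyond m u v m<size)) ⟩
  cube² N (suc m) (λ u v → cpWeight m u v * (𝟙 (exactlyParts α u) * 𝟙 (exactlyParts β v)))
    ≡⟨ cube²-cong N (suc m) (λ u v → rearrange (cpWeight m u v) (𝟙 (exactlyParts α u)) (𝟙 (exactlyParts β v))) ⟩
  cube² N (suc m) (λ u v → 𝟙 (exactlyParts α u) * (𝟙 (exactlyParts β v) * cpWeight m u v))
    ≡⟨ cube²-exactlyParts N m α β (cpWeight m) α≤N β≤N ⟩
  cube² N m (λ u v → 𝟙 (atMostParts α u) * (𝟙 (atMostParts β v) * cpWeight m (raise α u) (raise β v))) ∎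
  where
  open ≡-Reasoning
  rearrange : ∀ w a b → w * (a * b) ≡ a * (b * w)
  rearrange = solve-∀

exactCount-shift : ∀ N α β m → β ≤ α → α ≤ 3 + β → α ≤ N → α + β ≤ m →
                   exactCount N α β m ≡ count N (suc α) (suc β) (m ∸ (α + β))
exactCount-shift N α β m β≤α α≤3+β α≤N c≤m = begin
  exactCount N α β m
    ≡⟨ exactCount-raised N α β m α≤N β≤N ⟩
  cube² N m (λ u v → 𝟙 (atMostParts α u) * (𝟙 (atMostParts β v) * cpWeight m (raise α u) (raise β v)))
    ≡⟨ cube²-cong N m (λ u v → 𝟙-*-cong (atMostParts α u) (λ tu → 𝟙-*-cong (atMostParts β v) (λ tv →
         trans (cpWeight-raise m α β u v tu tv β≤α α≤3+β α≤N)
               (cong (λ e → 𝟙 (isCP30 (u , v) ∧ e)) (+-≡ᵇ-∸ (size (u , v)) (α + β) m c≤m))))) ⟩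
  cube² N m (λ u v → 𝟙 (atMostParts α u) * (𝟙 (atMostParts β v) * cpWeight (m ∸ (α + β)) u v))
    ≡⟨ cube²-cong N m (λ u v → rearrange (𝟙 (atMostParts α u)) (𝟙 (atMostParts β v)) (cpWeight (m ∸ (α + β)) u v)) ⟩
  cube² N m (λ u v → cpWeight (m ∸ (α + β)) u v * (𝟙 (atMostParts α u) * 𝟙 (atMostParts β v)))
    ≡⟨ cube²-bound N (m ∸ (α + β)) m (m ∸ (α + β)) (m∸n≤m m (α + β)) ≤-refl
         (λ u v m<size → cong (_* _) (cpWeight-beyond (m ∸ (α + β)) u v m<size)) ⟩
  count N (suc α) (suc β) (m ∸ (α + β)) ∎
  where
  open ≡-Reasoning
  β≤N = ≤-trans β≤α α≤N
  rearrange : ∀ a b w → a * (b * w) ≡ w * (a * b)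
  rearrange = solve-∀

exactCount-below : ∀ N α β m → β ≤ α → α ≤ 3 + β → α ≤ N → m < α + β → exactCount N α β m ≡ 0
exactCount-below N α β m β≤α α≤3+β α≤N m<c = trans (exactCount-raised N α β m α≤N (≤-trans β≤α α≤N))
  (cube²-zero N m (λ u v → trans
    (𝟙-*-cong (atMostParts α u) (λ tu → 𝟙-*-cong (atMostParts β v) (λ tv →
       trans (cpWeight-raise m α β u v tu tv β≤α α≤3+β α≤N)
             (trans (cong (λ e → 𝟙 (isCP30 (u , v) ∧ e)) (+-≡ᵇ-< (size (u , v)) (α + β) m m<c))
                    (cong 𝟙 (∧-zeroʳ (isCP30 (u , v))))))))
    (trans (cong (𝟙 (atMostParts α u) *_) (*-zeroʳ (𝟙 (atMostParts β v)))) (*-zeroʳ (𝟙 (atMostParts α u))))))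

count-fewer₂ : ∀ N γ δ m → γ ≤ δ → count N γ (suc δ) m ≡ count N γ δ m
count-fewer₂ N zero    δ       m _         = refl
count-fewer₂ N (suc α) (suc β) m (s≤s α≤β) = cube²-cong N m (λ u v →
  cpWeight-*-cong m u v (λ t → 𝟙-*-cong (atMostParts α u) (λ tu → cong 𝟙 (atMostParts-suc β v
    (VanishesFrom-mono {f = at v} α≤β
      (Cylindric30-vanishes₂ α (Equivalence.to (isCP30⇔ u v) t) (Equivalence.to (atMostParts⇔ α u) tu)))))))

count-fewer₁ : ∀ N γ δ m → 3 + δ ≤ γ → count N (suc γ) δ m ≡ count N γ δ m
count-fewer₁ N γ       zero    m _ = cube²-cong N m (λ u v →
  cong (cpWeight m u v *_) (trans (*-zeroʳ (𝟙 (fewerParts (suc γ) u))) (sym (*-zeroʳ (𝟙 (fewerParts γ u))))))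
count-fewer₁ N (suc α) (suc β) m (s≤s 3+β≤α) = cube²-cong N m (λ u v →
  cpWeight-*-cong m u v (λ t → *-𝟙-cong (atMostParts β v) (λ tv → cong 𝟙 (atMostParts-suc α u
    (VanishesFrom-mono {f = at u} 3+β≤α
      (Cylindric30-vanishes₁ β (Equivalence.to (isCP30⇔ u v) t) (Equivalence.to (atMostParts⇔ β v) tv)))))))

count-pad : ∀ N γ δ m → γ ≤ suc N → δ ≤ suc N → count (suc N) γ δ m ≡ count N γ δ m
count-pad N γ δ m γ≤1+N δ≤1+N = begin
  cube (suc N) m (λ u → cube (suc N) m (W u))
    ≡⟨ cube-∷ʳ N m (λ u → cube (suc N) m (W u)) ⟩
  cube N m (λ u → sum< (suc m) (λ x → cube (suc N) m (W (u ∷ʳ x))))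
    ≡⟨ cube-cong N m (λ u → sum<-head m (λ x → cube (suc N) m (W (u ∷ʳ x))) (λ x → cube-zero (suc N) m (λ v →
         *-≡0 (cpWeight m (u ∷ʳ suc x) v)
              (cong (λ b → 𝟙 b * 𝟙 (fewerParts δ v)) (fewerParts-∷ʳ-positive γ u x γ≤1+N))))) ⟩
  cube N m (λ u → cube (suc N) m (W (u ∷ʳ 0)))
    ≡⟨ cube-cong N m (λ u → cube-∷ʳ N m (W (u ∷ʳ 0))) ⟩
  cube N m (λ u → cube N m (λ v → sum< (suc m) (λ y → W (u ∷ʳ 0) (v ∷ʳ y))))
    ≡⟨ cube²-cong N m (λ u v → sum<-head m (λ y → W (u ∷ʳ 0) (v ∷ʳ y)) (λ y →
         *-≡0 (cpWeight m (u ∷ʳ 0) (v ∷ʳ suc y))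
         (*-≡0 (𝟙 (fewerParts γ (u ∷ʳ 0))) (cong 𝟙 (fewerParts-∷ʳ-positive δ v y δ≤1+N))))) ⟩
  cube² N m (λ u v → W (u ∷ʳ 0) (v ∷ʳ 0))
    ≡⟨ cube²-cong N m drop-zeros ⟩
  count N γ δ m ∎
  where
  open ≡-Reasoning
  W : Vec ℕ (suc N) → Vec ℕ (suc N) → ℕ
  W u v = cpWeight m u v * (𝟙 (fewerParts γ u) * 𝟙 (fewerParts δ v))
  drop-zeros : ∀ u v → W (u ∷ʳ 0) (v ∷ʳ 0) ≡ cpWeight m u v * (𝟙 (fewerParts γ u) * 𝟙 (fewerParts δ v))
  drop-zeros u v = cong₂ _*_
    (cong₂ (λ cp s → 𝟙 (cp ∧ (s ≡ᵇ m))) (isCP30-cong (u ∷ʳ 0) (v ∷ʳ 0) u v (at-∷ʳ0 u) (at-∷ʳ0 v))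
           (cong₂ _+_ (trans (vsum-∷ʳ u 0) (+-identityʳ _)) (trans (vsum-∷ʳ v 0) (+-identityʳ _))))
    (cong₂ (λ a b → 𝟙 a * 𝟙 b) (fewerParts-cong γ (u ∷ʳ 0) u (at-∷ʳ0 u))
                               (fewerParts-cong δ (v ∷ʳ 0) v (at-∷ʳ0 v)))

-- Power series

module ℤ-Sums = FiniteSums ℤ.+-0-isCommutativeMonoid

-- Power series are modelled as coefficient functions on ℤ (zero on negative exponents,
-- see Causal), so that multiplication by q^a is a reindexing and the operators below
-- commute pointwise.
Series : Set
Series = ℤ → ℤ

series : FPS → Series
series F (+ m)    = F m
series F -[1+ _ ] = +0

Causal : Series → Set
Causal F = ∀ j → F -[1+ j ] ≡ +0

shift : ℕ → Series → Series
shift a F x = F (x -ℤ + a)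

Δ : ℕ → Series → Series
Δ a F x = F x -ℤ shift a F x

infixl 6 _⊞_ _⊟_

_⊞_ : Series → Series → Series
(F ⊞ G) x = F x +ℤ G x

_⊟_ : Series → Series → Series
(F ⊟ G) x = F x -ℤ G x

m+n-n≡m : ∀ m n → m +ℤ n -ℤ n ≡ m
m+n-n≡m = ℤ-Solver.solve-∀

m+n-m≡n : ∀ m n → m +ℤ n -ℤ m ≡ n
m+n-m≡n = ℤ-Solver.solve-∀

+-−-≥ : ∀ {m c} → c ≤ m → + m -ℤ + c ≡ + (m ∸ c)
+-−-≥ {m} {c} c≤m = trans (ℤ.m-n≡m⊖n m c) (ℤ.⊖-≥ c≤m)

+-−-< : ∀ {m c} → m < c → + m -ℤ + c ≡ -[1+ (c ∸ suc m) ]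
+-−-< {m} {c} m<c = trans (ℤ.m-n≡m⊖n m c) (trans (ℤ.⊖-< m<c) (cong (-_ ∘ +_) (+-∸-assoc 1 m<c)))

-[1+]-−-+ : ∀ j a → -[1+ j ] -ℤ + a ≡ -[1+ (j + a) ]
-[1+]-−-+ j zero    = cong -[1+_] (sym (+-identityʳ j))
-[1+]-−-+ j (suc a) = cong -[1+_] (sym (+-suc j a))

Causal-series : ∀ F → Causal (series F)
Causal-series F j = refl

Causal-shift : ∀ a F → Causal F → Causal (shift a F)
Causal-shift a F causal j = trans (cong F (-[1+]-−-+ j a)) (causal (j + a))

Causal-⊟ : ∀ F G → Causal F → Causal G → Causal (F ⊟ G)
Causal-⊟ F G causalF causalG j = cong₂ _-ℤ_ (causalF j) (causalG j)

Causal-Δ : ∀ a F → Causal F → Causal (Δ a F)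
Causal-Δ a F causal = Causal-⊟ F (shift a F) causal (Causal-shift a F causal)

shift-series-≥ : ∀ c F {m} → c ≤ m → shift c (series F) (+ m) ≡ F (m ∸ c)
shift-series-≥ c F c≤m = cong (series F) (+-−-≥ c≤m)

shift-series-< : ∀ c F {m} → m < c → shift c (series F) (+ m) ≡ +0
shift-series-< c F m<c = cong (series F) (+-−-< m<c)

series-cong : ∀ {F G : FPS} → (∀ m → F m ≡ G m) → series F ≗ series G
series-cong F≡G (+ m)    = F≡G m
series-cong F≡G -[1+ j ] = refl

shift-cong : ∀ a {F G} → F ≗ G → shift a F ≗ shift a G
shift-cong a F≗G x = F≗G (x -ℤ + a)

Δ-cong : ∀ a {F G} → F ≗ G → Δ a F ≗ Δ a G
Δ-cong a F≗G x = cong₂ _-ℤ_ (F≗G x) (shift-cong a F≗G x)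

⊞-cong : ∀ {F F′ G G′} → F ≗ F′ → G ≗ G′ → F ⊞ G ≗ F′ ⊞ G′
⊞-cong F≗F′ G≗G′ x = cong₂ _+ℤ_ (F≗F′ x) (G≗G′ x)

⊟-cong : ∀ {F F′ G G′} → F ≗ F′ → G ≗ G′ → F ⊟ G ≗ F′ ⊟ G′
⊟-cong F≗F′ G≗G′ x = cong₂ _-ℤ_ (F≗F′ x) (G≗G′ x)

x-a-b≡x-b-a : ∀ x a b → x -ℤ a -ℤ b ≡ x -ℤ b -ℤ a
x-a-b≡x-b-a = ℤ-Solver.solve-∀

shift-+ : ∀ a b F → shift (a + b) F ≗ shift a (shift b F)
shift-+ a b F x = cong F (trans (cong (x +ℤ_) (ℤ.neg-distrib-+ (+ a) (+ b))) (sym (ℤ.+-assoc x _ _)))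

shift-comm : ∀ a b F → shift a (shift b F) ≗ shift b (shift a F)
shift-comm a b F x = cong F (x-a-b≡x-b-a x (+ a) (+ b))

Δ-shift : ∀ a c F → Δ a (shift c F) ≗ shift c (Δ a F)
Δ-shift a c F x = cong (shift c F x -ℤ_) (shift-comm a c F x)

Δ-comm : ∀ a b F → Δ a (Δ b F) ≗ Δ b (Δ a F)
Δ-comm a b F x = trans (cong (λ y → F x -ℤ F (x -ℤ + b) -ℤ (F (x -ℤ + a) -ℤ F y)) (x-a-b≡x-b-a x (+ a) (+ b)))
                       (interchange-− (F x) _ _ _)
  where
  interchange-− : ∀ p q r s → p -ℤ q -ℤ (r -ℤ s) ≡ p -ℤ r -ℤ (q -ℤ s)
  interchange-− = ℤ-Solver.solve-∀

Δ-⊞ : ∀ a F G → Δ a (F ⊞ G) ≗ Δ a F ⊞ Δ a G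
Δ-⊞ a F G x = rearrange (F x) (G x) _ _
  where
  rearrange : ∀ p q r s → p +ℤ q -ℤ (r +ℤ s) ≡ p -ℤ r +ℤ (q -ℤ s)
  rearrange = ℤ-Solver.solve-∀

Δ-⊟ : ∀ a F G → Δ a (F ⊟ G) ≗ Δ a F ⊟ Δ a G
Δ-⊟ a F G x = rearrange (F x) (G x) _ _
  where
  rearrange : ∀ p q r s → p -ℤ q -ℤ (r -ℤ s) ≡ p -ℤ r -ℤ (q -ℤ s)
  rearrange = ℤ-Solver.solve-∀

Δ-linear : ∀ a F G H → Δ a (F ⊞ G ⊟ H) ≗ Δ a F ⊞ Δ a G ⊟ Δ a H
Δ-linear a F G H x = trans (Δ-⊟ a (F ⊞ G) H x) (cong (_-ℤ Δ a H x) (Δ-⊞ a F G x))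

Δ-shifts : ∀ a b c F → Δ a (F ⊞ shift b F ⊞ shift c F) ≗ Δ a F ⊞ shift b (Δ a F) ⊞ shift c (Δ a F)
Δ-shifts a b c F x = trans (Δ-⊞ a (F ⊞ shift b F) (shift c F) x)
  (cong₂ _+ℤ_ (trans (Δ-⊞ a F (shift b F) x) (cong (Δ a F x +ℤ_) (Δ-shift a b F x))) (Δ-shift a c F x))

Δ-injective : ∀ k F G → 0 < k → Causal F → Causal G → Δ k F ≗ Δ k G → F ≗ G
Δ-injective k F G 0<k causalF causalG ΔF≗ΔG -[1+ j ] = trans (causalF j) (sym (causalG j))
Δ-injective k F G 0<k causalF causalG ΔF≗ΔG (+ m)    = <-rec (λ m → F (+ m) ≡ G (+ m)) step m
  where
  open ≡-Reasoning
  Δ+shift : ∀ H x → H x ≡ Δ k H x +ℤ shift k H x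
  Δ+shift H x = p≡p-q+q (H x) (shift k H x)
    where
    p≡p-q+q : ∀ p q → p ≡ p -ℤ q +ℤ q
    p≡p-q+q = ℤ-Solver.solve-∀
  step : ∀ m → (∀ {m′} → m′ < m → F (+ m′) ≡ G (+ m′)) → F (+ m) ≡ G (+ m)
  step m earlier = begin
    F (+ m)                              ≡⟨ Δ+shift F (+ m) ⟩
    Δ k F (+ m) +ℤ shift k F (+ m)       ≡⟨ cong₂ _+ℤ_ (ΔF≗ΔG (+ m)) shifted ⟩
    Δ k G (+ m) +ℤ shift k G (+ m)       ≡⟨ Δ+shift G (+ m) ⟨
    G (+ m)                              ∎
    where
    shifted : shift k F (+ m) ≡ shift k G (+ m)
    shifted with k ≤? m
    ... | yes k≤m = trans (cong F (+-−-≥ k≤m)) (trans (earlier (∸-monoʳ-< 0<k k≤m)) (cong G (sym (+-−-≥ k≤m))))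
    ... | no  k≰m = trans (cong F (+-−-< (≰⇒> k≰m)))
                      (trans (causalF _) (trans (sym (causalG _)) (cong G (sym (+-−-< (≰⇒> k≰m))))))

Δ* : List ℕ → Series → Series
Δ* []       F = F
Δ* (a ∷ as) F = Δ a (Δ* as F)

Δ*-cong : ∀ as {F G} → F ≗ G → Δ* as F ≗ Δ* as G
Δ*-cong []       F≗G = F≗G
Δ*-cong (a ∷ as) F≗G = Δ-cong a (Δ*-cong as F≗G)

Δ*-⊟ : ∀ as F G → Δ* as (F ⊟ G) ≗ Δ* as F ⊟ Δ* as G
Δ*-⊟ []       F G x = refl
Δ*-⊟ (a ∷ as) F G x = trans (Δ-cong a (Δ*-⊟ as F G) x) (Δ-⊟ a (Δ* as F) (Δ* as G) x)

Δ*-shift : ∀ as c F → Δ* as (shift c F) ≗ shift c (Δ* as F)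
Δ*-shift []       c F x = refl
Δ*-shift (a ∷ as) c F x = trans (Δ-cong a (Δ*-shift as c F) x) (Δ-shift a c (Δ* as F) x)

Causal-Δ* : ∀ as F → Causal F → Causal (Δ* as F)
Causal-Δ* []       F causal = causal
Causal-Δ* (a ∷ as) F causal = Causal-Δ a (Δ* as F) (Causal-Δ* as F causal)

Δ*-injective : ∀ as F G → All (0 <_) as → Causal F → Causal G → Δ* as F ≗ Δ* as G → F ≗ G
Δ*-injective []       F G []           _       _       F≗G = F≗G
Δ*-injective (a ∷ as) F G (0<a ∷ 0<as) causalF causalG ΔF≗ΔG = Δ*-injective as F G 0<as causalF causalG
  (Δ-injective a (Δ* as F) (Δ* as G) 0<a (Causal-Δ* as F causalF) (Causal-Δ* as G causalG) ΔF≗ΔG)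

Δ*-↭ : ∀ {as bs} F → as ↭ bs → Δ* as F ≗ Δ* bs F
Δ*-↭ F ↭.refl                          x = refl
Δ*-↭ F (↭.prep a as↭bs)                x = Δ-cong a (Δ*-↭ F as↭bs) x
Δ*-↭ F (↭.swap {ys = bs} a b as↭bs)    x = trans (Δ-cong a (Δ-cong b (Δ*-↭ F as↭bs)) x) (Δ-comm a b (Δ* bs F) x)
Δ*-↭ F (↭.trans as↭bs bs↭cs)           x = trans (Δ*-↭ F as↭bs x) (Δ*-↭ F bs↭cs x)

Σ≤-sum< : ∀ m h → Σ≤ m h ≡ ℤ-Sums.sum< (suc m) h
Σ≤-sum< zero    h = sym (ℤ.+-identityʳ (h 0))
Σ≤-sum< (suc m) h = trans (cong (_+ℤ h (suc m)) (Σ≤-sum< m h)) (sym (ℤ-Sums.sum<-snoc (suc m) h))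

series-⊖ : ∀ F G → series (F ⊖ G) ≗ series F ⊟ series G
series-⊖ F G (+ m)    = refl
series-⊖ F G -[1+ j ] = refl

series-one⊛ : ∀ F → series (one ⊛ F) ≗ series F
series-one⊛ F -[1+ j ] = refl
series-one⊛ F (+ m)    = trans (Σ≤-sum< m (λ i → one i *ℤ F (m ∸ i)))
  (trans (ℤ-Sums.sum<-head m (λ i → one i *ℤ F (m ∸ i)) (λ _ → refl)) (ℤ.*-identityˡ (F m)))

series-qpow⊛ : ∀ c F → series (qpow c ⊛ F) ≗ shift c (series F)
series-qpow⊛ c F -[1+ j ] = sym (Causal-shift c (series F) (Causal-series F) j)
series-qpow⊛ c F (+ m)    = trans (Σ≤-sum< m h) (case c ≤? m of λ where
  (yes c≤m) → begin
    ℤ-Sums.sum< (suc m) h  ≡⟨ ℤ-Sums.sum<-single (suc m) c (s≤s c≤m) (λ i _ i≢c → qpow-≢ (i≢c ∘ sym)) ⟩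
    qpow c c *ℤ F (m ∸ c)  ≡⟨ cong (_*ℤ F (m ∸ c)) (if-T (c ≡ᵇ c) (≡⇒≡ᵇ c c refl)) ⟩
    + 1 *ℤ F (m ∸ c)       ≡⟨ ℤ.*-identityˡ _ ⟩
    F (m ∸ c)              ≡⟨ shift-series-≥ c F c≤m ⟨
    shift c (series F) (+ m) ∎
  (no c≰m) → trans
    (ℤ-Sums.sum<-zero (suc m) (λ i i≤m → qpow-≢ (λ c≡i → c≰m (subst (_≤ m) (sym c≡i) (s≤s⁻¹ i≤m)))))
                   (sym (shift-series-< c F (≰⇒> c≰m))))
  where
  open ≡-Reasoning
  h : ℕ → ℤ
  h i = qpow c i *ℤ F (m ∸ i)
  qpow-≢ : ∀ {i} → c ≢ i → h i ≡ +0
  qpow-≢ {i} c≢i = cong (_*ℤ F (m ∸ i)) (if-¬T (c ≡ᵇ i) (c≢i ∘ ≡ᵇ⇒≡ c i))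

series-⊕⊛ : ∀ f g F → series ((f ⊕ g) ⊛ F) ≗ series (f ⊛ F) ⊞ series (g ⊛ F)
series-⊕⊛ f g F -[1+ j ] = refl
series-⊕⊛ f g F (+ m)    = begin
  Σ≤ m (λ i → (f i +ℤ g i) *ℤ F (m ∸ i))
    ≡⟨ Σ≤-sum< m _ ⟩
  ℤ-Sums.sum< (suc m) (λ i → (f i +ℤ g i) *ℤ F (m ∸ i))
    ≡⟨ ℤ-Sums.sum<-cong (suc m) (λ i _ → ℤ.*-distribʳ-+ (F (m ∸ i)) (f i) (g i)) ⟩
  ℤ-Sums.sum< (suc m) (λ i → f i *ℤ F (m ∸ i) +ℤ g i *ℤ F (m ∸ i))
    ≡⟨ ℤ-Sums.sum<-∙ (suc m) (λ i → f i *ℤ F (m ∸ i)) (λ i → g i *ℤ F (m ∸ i)) ⟩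
  ℤ-Sums.sum< (suc m) (λ i → f i *ℤ F (m ∸ i)) +ℤ ℤ-Sums.sum< (suc m) (λ i → g i *ℤ F (m ∸ i))
    ≡⟨ cong₂ _+ℤ_ (Σ≤-sum< m _) (Σ≤-sum< m _) ⟨
  Σ≤ m (λ i → f i *ℤ F (m ∸ i)) +ℤ Σ≤ m (λ i → g i *ℤ F (m ∸ i)) ∎
  where open ≡-Reasoning

geomInv-test⇔∣ : ∀ k m → 0 < k → T (anyB (λ j → k * j ≡ᵇ m) (upTo (suc m))) ⇔ k ∣ m
geomInv-test⇔∣ k m 0<k = mk⇔
  (λ t → let (j , _ , kj≡m) = Equivalence.to (T-anyB-applyUpTo _ id (suc m)) t in
         divides j (trans (sym (≡ᵇ⇒≡ (k * j) m kj≡m)) (*-comm k j)))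
  (λ where
    (divides j m≡jk) → Equivalence.from (T-anyB-applyUpTo _ id (suc m))
      (j , s≤s (subst (j ≤_) (sym m≡jk) (m≤m*n j k {{>-nonZero 0<k}})) ,
       ≡⇒≡ᵇ (k * j) m (trans (*-comm k j) (sym m≡jk))))

geomInv-∣ : ∀ k m → 0 < k → k ∣ m → geomInv k m ≡ + 1
geomInv-∣ k m 0<k k∣m = if-T _ (Equivalence.from (geomInv-test⇔∣ k m 0<k) k∣m)

geomInv-∤ : ∀ k m → 0 < k → ¬ k ∣ m → geomInv k m ≡ +0
geomInv-∤ k m 0<k k∤m = if-¬T _ (k∤m ∘ Equivalence.to (geomInv-test⇔∣ k m 0<k))

geomInv-periodic : ∀ k i → 0 < k → geomInv k (k + i) ≡ geomInv k i
geomInv-periodic k i 0<k with k ∣? i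
... | yes k∣i = trans (geomInv-∣ k (k + i) 0<k (∣m∣n⇒∣m+n ∣-refl k∣i)) (sym (geomInv-∣ k i 0<k k∣i))
... | no  k∤i = trans (geomInv-∤ k (k + i) 0<k (k∤i ∘ flip ∣m+n∣m⇒∣n ∣-refl)) (sym (geomInv-∤ k i 0<k k∤i))

geomInv⊛-leading : ∀ k (F : FPS) m n → 0 < n → n ≤ k → ℤ-Sums.sum< n (λ i → geomInv k i *ℤ F (m ∸ i)) ≡ F m
geomInv⊛-leading k F m n 0<n n≤k = trans
  (ℤ-Sums.sum<-single n 0 0<n (λ where
    zero    _     0≢0 → ⊥-elim (0≢0 refl)
    (suc i) 1+i<n _   → cong (_*ℤ F (m ∸ suc i))
      (geomInv-∤ k (suc i) 0<k (λ k∣1+i → <⇒≱ (<-≤-trans 1+i<n n≤k) (∣⇒≤ k∣1+i)))))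
  (trans (cong (_*ℤ F m) (geomInv-∣ k 0 0<k (k ∣0))) (ℤ.*-identityˡ (F m)))
  where
  0<k = <-≤-trans 0<n n≤k

geomInv⊛-recurrence : ∀ k F → 0 < k → series (geomInv k ⊛ F) ≗ series F ⊞ shift k (series (geomInv k ⊛ F))
geomInv⊛-recurrence k F 0<k -[1+ j ] = sym (cong (+0 +ℤ_) (Causal-shift k (series G) (Causal-series G) j))
  where G = geomInv k ⊛ F
geomInv⊛-recurrence k F 0<k (+ m)    = trans (Σ≤-sum< m (h m)) (case k ≤? m of λ where
  (yes k≤m) → let r = m ∸ k in begin
    ℤ-Sums.sum< (suc m) (h m)
      ≡⟨ cong (λ n → ℤ-Sums.sum< n (h m)) (trans (+-suc k r) (cong suc (m+[n∸m]≡n k≤m))) ⟨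
    ℤ-Sums.sum< (k + suc r) (h m)
      ≡⟨ ℤ-Sums.sum<-split k (suc r) (h m) ⟩
    ℤ-Sums.sum< k (h m) +ℤ ℤ-Sums.sum< (suc r) (λ i → h m (k + i))
      ≡⟨ cong₂ _+ℤ_ (geomInv⊛-leading k F m k 0<k ≤-refl) (ℤ-Sums.sum<-cong (suc r) (λ i _ →
           cong₂ _*ℤ_ (geomInv-periodic k i 0<k) (cong F (sym (∸-+-assoc m k i))))) ⟩
    F m +ℤ ℤ-Sums.sum< (suc r) (h r)
      ≡⟨ cong (F m +ℤ_) (trans (sym (Σ≤-sum< r (h r))) (sym (shift-series-≥ k G k≤m))) ⟩
    F m +ℤ shift k (series G) (+ m) ∎
  (no k≰m) → trans (geomInv⊛-leading k F m (suc m) z<s (≰⇒> k≰m))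
                   (trans (sym (ℤ.+-identityʳ (F m))) (cong (F m +ℤ_) (sym (shift-series-< k G (≰⇒> k≰m))))))
  where
  open ≡-Reasoning
  G = geomInv k ⊛ F
  h : ℕ → ℕ → ℤ
  h m i = geomInv k i *ℤ F (m ∸ i)

Δ-geomInv⊛ : ∀ k F → 0 < k → Δ k (series (geomInv k ⊛ F)) ≗ series F
Δ-geomInv⊛ k F 0<k x = trans (cong (_-ℤ shift k G x) (geomInv⊛-recurrence k F 0<k x)) (m+n-n≡m (series F x) _)
  where
  G = series (geomInv k ⊛ F)

-- The functional equation

countSeries : (N γ δ : ℕ) → Series
countSeries N γ δ = series (λ m → + count N γ δ m)

series-CP30 : ∀ n → series (CP30 n) ≗ countSeries n (suc n) (suc n)
series-CP30 n = series-cong (cong +_ ∘ cpCount≡count n)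

countSeries-fewer₂ : ∀ N γ δ → γ ≤ δ → countSeries N γ (suc δ) ≗ countSeries N γ δ
countSeries-fewer₂ N γ δ γ≤δ = series-cong (λ m → cong +_ (count-fewer₂ N γ δ m γ≤δ))

countSeries-fewer₁ : ∀ N γ δ → 3 + δ ≤ γ → countSeries N (suc γ) δ ≗ countSeries N γ δ
countSeries-fewer₁ N γ δ 3+δ≤γ = series-cong (λ m → cong +_ (count-fewer₁ N γ δ m 3+δ≤γ))

countSeries-pad : ∀ N γ δ → γ ≤ suc N → δ ≤ suc N → countSeries (suc N) γ δ ≗ countSeries N γ δ
countSeries-pad N γ δ γ≤1+N δ≤1+N = series-cong (λ m → cong +_ (count-pad N γ δ m γ≤1+N δ≤1+N))

countSeries-none₂ : ∀ N γ → countSeries N γ 0 ≗ λ _ → +0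
countSeries-none₂ N γ (+ m)    = cong +_ (cube²-zero N m (λ u v → *-≡0 (cpWeight m u v) (*-zeroʳ (𝟙 (fewerParts γ u)))))
countSeries-none₂ N γ -[1+ j ] = refl

series-exactCount : ∀ N α β → β ≤ α → α ≤ 3 + β → α ≤ N →
                    series (λ m → + exactCount N α β m) ≗ shift (α + β) (countSeries N (suc α) (suc β))
series-exactCount N α β β≤α α≤3+β α≤N -[1+ j ] =
  sym (Causal-shift (α + β) (countSeries N (suc α) (suc β)) (Causal-series (λ m → + count N (suc α) (suc β) m)) j)
series-exactCount N α β β≤α α≤3+β α≤N (+ m) with α + β ≤? m
... | yes c≤m = trans (cong +_ (exactCount-shift N α β m β≤α α≤3+β α≤N c≤m)) (sym (shift-series-≥ (α + β) _ c≤m))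
... | no  c≰m = trans (cong +_ (exactCount-below N α β m β≤α α≤3+β α≤N (≰⇒> c≰m)))
                     (sym (shift-series-< (α + β) _ (≰⇒> c≰m)))

-- Valid in the range β ≤ α ≤ β + 3, where lowering all parts of both partitions by one
-- preserves the cylindric conditions.
countSeries-functional : ∀ N α β → β ≤ α → α ≤ 3 + β → α ≤ N →
  Δ (α + β) (countSeries N (suc α) (suc β)) ≗ countSeries N α (suc β) ⊞ countSeries N (suc α) β ⊟ countSeries N α β
countSeries-functional N α β β≤α α≤3+β α≤N -[1+ j ] =
  Causal-Δ (α + β) (countSeries N (suc α) (suc β)) (Causal-series (λ m → + count N (suc α) (suc β) m)) j
countSeries-functional N α β β≤α α≤3+β α≤N (+ m)    = begin
  + count N (suc α) (suc β) m -ℤ shift (α + β) (countSeries N (suc α) (suc β)) (+ m)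
    ≡⟨ cong (+ count N (suc α) (suc β) m -ℤ_) (series-exactCount N α β β≤α α≤3+β α≤N (+ m)) ⟨
  + count N (suc α) (suc β) m -ℤ + exactCount N α β m
    ≡⟨ cancel {count N (suc α) (suc β) m} {count N α β m} {count N α (suc β) m} {count N (suc α) β m}
              {exactCount N α β m} (count-split N α β m) ⟩
  + count N α (suc β) m +ℤ + count N (suc α) β m -ℤ + count N α β m ∎
  where
  open ≡-Reasoning
  cancel : ∀ {a b c d e} → a + b ≡ e + c + d → + a -ℤ + e ≡ + c +ℤ + d -ℤ + b
  cancel {a} {b} {c} {d} {e} a+b≡e+c+d = begin
    + a -ℤ + e                          ≡⟨ add-sub (+ a) (+ b) (+ e) ⟩
    + a +ℤ + b -ℤ + e -ℤ + b            ≡⟨ cong (λ s → s -ℤ + e -ℤ + b) (ℤ.pos-+ a b) ⟨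
    + (a + b) -ℤ + e -ℤ + b             ≡⟨ cong (λ s → + s -ℤ + e -ℤ + b) a+b≡e+c+d ⟩
    + (e + c + d) -ℤ + e -ℤ + b         ≡⟨ cong (λ s → s -ℤ + e -ℤ + b)
                                             (trans (ℤ.pos-+ (e + c) d) (cong (_+ℤ + d) (ℤ.pos-+ e c))) ⟩
    + e +ℤ + c +ℤ + d -ℤ + e -ℤ + b     ≡⟨ drop-e (+ e) (+ c) (+ d) (+ b) ⟩
    + c +ℤ + d -ℤ + b                   ∎
    where
    add-sub : ∀ p q r → p -ℤ r ≡ p +ℤ q -ℤ r -ℤ q
    add-sub = ℤ-Solver.solve-∀
    drop-e : ∀ e c d b → e +ℤ c +ℤ d -ℤ e -ℤ b ≡ c +ℤ d -ℤ b
    drop-e = ℤ-Solver.solve-∀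

countSeries-corner : ∀ k → Δ (suc (k + k)) (countSeries (2 + k) (3 + k) k) ≗ countSeries (2 + k) (2 + k) k
countSeries-corner zero    x = trans (Δ-cong 1 (countSeries-none₂ 2 3) x) (sym (countSeries-none₂ 2 2 x))
countSeries-corner (suc k) x = begin
  Δ (suc (suc k + suc k)) (G (4 + k) (suc k)) x
    ≡⟨ cong (λ c → Δ c (G (4 + k) (suc k)) x) (cong (_+_ 2) (+-suc k k)) ⟩
  Δ (3 + k + k) (G (4 + k) (suc k)) x
    ≡⟨ countSeries-functional (3 + k) (3 + k) k (m≤n+m k 3) ≤-refl ≤-refl x ⟩
  G (3 + k) (suc k) x +ℤ G (4 + k) k x -ℤ G (3 + k) k x
    ≡⟨ cong (λ g → G (3 + k) (suc k) x +ℤ g -ℤ G (3 + k) k x) (countSeries-fewer₁ (3 + k) (3 + k) k ≤-refl x) ⟩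
  G (3 + k) (suc k) x +ℤ G (3 + k) k x -ℤ G (3 + k) k x
    ≡⟨ m+n-n≡m _ _ ⟩
  G (3 + k) (suc k) x ∎
  where
  open ≡-Reasoning
  G = countSeries (3 + k)

-- With n = k + 2, the exponents a₁ … a₄ are 2n - 3 … 2n and a₁ + a₀ = 4n - 7; in the
-- lemma names Gᵢⱼ stands for G (i + k) (j + k).
module Elimination (k : ℕ) where

  a₀ a₁ a₂ a₃ a₄ : ℕ
  a₀ = k + k
  a₁ = suc a₀
  a₂ = suc a₁
  a₃ = suc a₂
  a₄ = suc a₃

  G : ℕ → ℕ → Series
  G = countSeries (2 + k)

  Q : Series
  Q = G (1 + k) (1 + k) ⊞ G (2 + k) k ⊟ G (1 + k) k

  private
    functional : ∀ α β {c} → α + β ≡ c → β ≤ α → α ≤ 3 + β → α ≤ 2 + k →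
                 Δ c (G (suc α) (suc β)) ≗ G α (suc β) ⊞ G (suc α) β ⊟ G α β
    functional α β refl = countSeries-functional (2 + k) α β

  Δa₄-G₃₃ : Δ a₄ (G (3 + k) (3 + k)) ≗ G (3 + k) (2 + k)
  Δa₄-G₃₃ x = trans
    (functional (2 + k) (2 + k) (cong (_+_ 2) (trans (+-suc k (suc k)) (cong suc (+-suc k k)))) ≤-refl (m≤n+m _ 3) ≤-refl x)
    (trans (cong (λ g → g +ℤ G (3 + k) (2 + k) x -ℤ G (2 + k) (2 + k) x) (countSeries-fewer₂ (2 + k) (2 + k) (2 + k) ≤-refl x))
           (m+n-m≡n (G (2 + k) (2 + k) x) _))

  Δa₃-G₃₂ : Δ a₃ (G (3 + k) (2 + k)) ≗ G (2 + k) (2 + k) ⊞ G (3 + k) (1 + k) ⊟ G (2 + k) (1 + k)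
  Δa₃-G₃₂ = functional (2 + k) (1 + k) (cong (_+_ 2) (+-suc k k)) (n≤1+n _) (m≤n+m _ 2) ≤-refl

  Δa₂-G₂₂ : Δ a₂ (G (2 + k) (2 + k)) ≗ G (2 + k) (1 + k)
  Δa₂-G₂₂ x = trans
    (functional (1 + k) (1 + k) (cong suc (+-suc k k)) ≤-refl (m≤n+m _ 3) (n≤1+n _) x)
    (trans (cong (λ g → g +ℤ G (2 + k) (1 + k) x -ℤ G (1 + k) (1 + k) x) (countSeries-fewer₂ (2 + k) (1 + k) (1 + k) ≤-refl x))
           (m+n-m≡n (G (1 + k) (1 + k) x) _))

  Δa₂-G₃₁ : Δ a₂ (G (3 + k) (1 + k)) ≗ G (2 + k) (1 + k) ⊞ G (3 + k) k ⊟ G (2 + k) k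
  Δa₂-G₃₁ = functional (2 + k) k refl (m≤n+m k 2) (m≤n+m _ 1) ≤-refl

  Δa₁-G₂₁ : Δ a₁ (G (2 + k) (1 + k)) ≗ Q
  Δa₁-G₂₁ = functional (1 + k) k refl (n≤1+n k) (m≤n+m _ 2) (n≤1+n _)

  Δa₁-G₃₀ : Δ a₁ (G (3 + k) k) ≗ G (2 + k) k
  Δa₁-G₃₀ = countSeries-corner k

  Δa₀-G₁₁ : Δ a₀ (G (1 + k) (1 + k)) ≗ G (1 + k) k
  Δa₀-G₁₁ x = trans
    (functional k k refl ≤-refl (m≤n+m k 3) (m≤n+m k 2) x)
    (trans (cong (λ g → g +ℤ G (1 + k) k x -ℤ G k k x) (countSeries-fewer₂ (2 + k) k k ≤-refl x)) (m+n-m≡n (G k k x) _))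

  Δ²-G₂₂ : Δ a₂ (Δ a₁ (G (2 + k) (2 + k))) ≗ Q
  Δ²-G₂₂ x = trans (Δ-comm a₂ a₁ (G (2 + k) (2 + k)) x) (trans (Δ-cong a₁ Δa₂-G₂₂ x) (Δa₁-G₂₁ x))

  Δ²-G₃₁ : Δ a₂ (Δ a₁ (G (3 + k) (1 + k))) ≗ Q ⊞ G (2 + k) k ⊟ Δ a₁ (G (2 + k) k)
  Δ²-G₃₁ x = trans (Δ-comm a₂ a₁ (G (3 + k) (1 + k)) x) (trans (Δ-cong a₁ Δa₂-G₃₁ x)
    (trans (Δ-linear a₁ (G (2 + k) (1 + k)) (G (3 + k) k) (G (2 + k) k) x)
    (cong₂ (λ p q → p +ℤ q -ℤ Δ a₁ (G (2 + k) k) x) (Δa₁-G₂₁ x) (Δa₁-G₃₀ x))))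

  -- Q at x - a₁ contains G (1 + k) k, which Δa₀-G₁₁ trades for (1 - q^{a₀}) G (1 + k) (1 + k).
  regroup : Q ⊞ (Q ⊞ G (2 + k) k ⊟ Δ a₁ (G (2 + k) k)) ⊟ Δ a₂ Q ≗
            Q ⊞ shift a₁ Q ⊞ shift a₂ Q ⊟ shift (a₁ + a₀) (G (1 + k) (1 + k))
  regroup x = begin
    Q x +ℤ (Q x +ℤ C x -ℤ (C x -ℤ C y)) -ℤ (Q x -ℤ Q (x -ℤ + a₂))
      ≡⟨ rearrange (Q x) (C x) (C y) (Q (x -ℤ + a₂)) (A y) (A z) ⟩
    Q x +ℤ (A y +ℤ C y -ℤ (A y -ℤ A z)) +ℤ Q (x -ℤ + a₂) -ℤ A z
      ≡⟨ cong (λ b → Q x +ℤ (A y +ℤ C y -ℤ b) +ℤ Q (x -ℤ + a₂) -ℤ A z) (Δa₀-G₁₁ y) ⟩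
    Q x +ℤ Q y +ℤ Q (x -ℤ + a₂) -ℤ A z
      ≡⟨ cong (Q x +ℤ Q y +ℤ Q (x -ℤ + a₂) -ℤ_) (shift-+ a₁ a₀ A x) ⟨
    Q x +ℤ Q y +ℤ Q (x -ℤ + a₂) -ℤ shift (a₁ + a₀) A x ∎
    where
    open ≡-Reasoning
    A = G (1 + k) (1 + k)
    C = G (2 + k) k
    y = x -ℤ + a₁
    z = y -ℤ + a₀
    rearrange : ∀ q c c′ q′ a a′ →
                q +ℤ (q +ℤ c -ℤ (c -ℤ c′)) -ℤ (q -ℤ q′) ≡ q +ℤ (a +ℤ c′ -ℤ (a -ℤ a′)) +ℤ q′ -ℤ a′
    rearrange = ℤ-Solver.solve-∀

  core : Δ* (a₂ ∷ a₁ ∷ a₃ ∷ a₄ ∷ []) (G (3 + k) (3 + k)) ≗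
         Q ⊞ shift a₁ Q ⊞ shift a₂ Q ⊟ shift (a₁ + a₀) (G (1 + k) (1 + k))
  core = begin
    Δ a₂ (Δ a₁ (Δ a₃ (Δ a₄ (G (3 + k) (3 + k)))))
      ≈⟨ Δ-cong a₂ (Δ-cong a₁ (λ x → trans (Δ-cong a₃ Δa₄-G₃₃ x) (Δa₃-G₃₂ x))) ⟩
    Δ a₂ (Δ a₁ (G (2 + k) (2 + k) ⊞ G (3 + k) (1 + k) ⊟ G (2 + k) (1 + k)))
      ≈⟨ (λ x → trans (Δ-cong a₂ (Δ-linear a₁ (G (2 + k) (2 + k)) (G (3 + k) (1 + k)) (G (2 + k) (1 + k))) x)
                      (Δ-linear a₂ (Δ a₁ (G (2 + k) (2 + k))) (Δ a₁ (G (3 + k) (1 + k))) (Δ a₁ (G (2 + k) (1 + k))) x)) ⟩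
    Δ a₂ (Δ a₁ (G (2 + k) (2 + k))) ⊞ Δ a₂ (Δ a₁ (G (3 + k) (1 + k))) ⊟ Δ a₂ (Δ a₁ (G (2 + k) (1 + k)))
      ≈⟨ ⊟-cong (⊞-cong Δ²-G₂₂ Δ²-G₃₁) (Δ-cong a₂ Δa₁-G₂₁) ⟩
    Q ⊞ (Q ⊞ G (2 + k) k ⊟ Δ a₁ (G (2 + k) k)) ⊟ Δ a₂ Q
      ≈⟨ regroup ⟩
    Q ⊞ shift a₁ Q ⊞ shift a₂ Q ⊟ shift (a₁ + a₀) (G (1 + k) (1 + k)) ∎
    where open SetoidReasoning (ℤ →-setoid ℤ)

  series-CP30₂ : series (CP30 (2 + k)) ≗ G (3 + k) (3 + k)
  series-CP30₂ = series-CP30 (2 + k)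

  series-CP30₁ : series (CP30 (1 + k)) ≗ G (2 + k) (2 + k)
  series-CP30₁ x = trans (series-CP30 (1 + k) x) (sym (countSeries-pad (1 + k) (2 + k) (2 + k) ≤-refl ≤-refl x))

  series-CP30₀ : series (CP30 k) ≗ G (1 + k) (1 + k)
  series-CP30₀ x = trans (series-CP30 k x) (sym (trans (countSeries-pad (1 + k) (1 + k) (1 + k) (n≤1+n _) (n≤1+n _) x)
                                                       (countSeries-pad k (1 + k) (1 + k) ≤-refl ≤-refl x)))

  L : List ℕ
  L = a₂ ∷ a₁ ∷ a₃ ∷ a₄ ∷ []

  P X Y : FPS
  P = ((one ⊕ qpow a₁) ⊕ qpow a₂) ⊛ CP30 (1 + k)
  X = geomInv a₃ ⊛ (geomInv a₄ ⊛ P)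
  Y = qpow (a₁ + a₀) ⊛ (geomInv a₁ ⊛ (geomInv a₂ ⊛ (geomInv a₃ ⊛ (geomInv a₄ ⊛ CP30 k))))

  series-P : series P ≗ G (2 + k) (2 + k) ⊞ shift a₁ (G (2 + k) (2 + k)) ⊞ shift a₂ (G (2 + k) (2 + k))
  series-P x = trans (series-⊕⊛ (one ⊕ qpow a₁) (qpow a₂) (CP30 (1 + k)) x) (cong₂ _+ℤ_
    (trans (series-⊕⊛ one (qpow a₁) (CP30 (1 + k)) x) (cong₂ _+ℤ_
      (trans (series-one⊛ (CP30 (1 + k)) x) (series-CP30₁ x))
      (trans (series-qpow⊛ a₁ (CP30 (1 + k)) x) (shift-cong a₁ series-CP30₁ x))))
    (trans (series-qpow⊛ a₂ (CP30 (1 + k)) x) (shift-cong a₂ series-CP30₁ x)))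

  Δ*-X : Δ* L (series X) ≗ Q ⊞ shift a₁ Q ⊞ shift a₂ Q
  Δ*-X = begin
    Δ a₂ (Δ a₁ (Δ a₃ (Δ a₄ (series X))))
      ≈⟨ Δ*-↭ (series X) inner-swap ⟩
    Δ a₂ (Δ a₁ (Δ a₄ (Δ a₃ (series X))))
      ≈⟨ Δ-cong a₂ (Δ-cong a₁ (λ x →
           trans (Δ-cong a₄ (Δ-geomInv⊛ a₃ (geomInv a₄ ⊛ P) z<s) x) (Δ-geomInv⊛ a₄ P z<s x))) ⟩
    Δ a₂ (Δ a₁ (series P))
      ≈⟨ Δ-cong a₂ (Δ-cong a₁ series-P) ⟩
    Δ a₂ (Δ a₁ (A ⊞ shift a₁ A ⊞ shift a₂ A))
      ≈⟨ (λ x → trans (Δ-cong a₂ (Δ-shifts a₁ a₁ a₂ A) x) (Δ-shifts a₂ a₁ a₂ (Δ a₁ A) x)) ⟩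
    Δ a₂ (Δ a₁ A) ⊞ shift a₁ (Δ a₂ (Δ a₁ A)) ⊞ shift a₂ (Δ a₂ (Δ a₁ A))
      ≈⟨ ⊞-cong (⊞-cong Δ²-G₂₂ (shift-cong a₁ Δ²-G₂₂)) (shift-cong a₂ Δ²-G₂₂) ⟩
    Q ⊞ shift a₁ Q ⊞ shift a₂ Q ∎
    where
    open SetoidReasoning (ℤ →-setoid ℤ)
    A = G (2 + k) (2 + k)
    inner-swap : L ↭ a₂ ∷ a₁ ∷ a₄ ∷ a₃ ∷ []
    inner-swap = ↭.prep a₂ (↭.prep a₁ (↭.swap a₃ a₄ ↭.refl))

  Δ*-Y : Δ* L (series Y) ≗ shift (a₁ + a₀) (G (1 + k) (1 + k))
  Δ*-Y = begin
    Δ* L (series Y)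
      ≈⟨ Δ*-cong L (series-qpow⊛ (a₁ + a₀) Y₁) ⟩
    Δ* L (shift (a₁ + a₀) (series Y₁))
      ≈⟨ Δ*-shift L (a₁ + a₀) (series Y₁) ⟩
    shift (a₁ + a₀) (Δ* L (series Y₁))
      ≈⟨ shift-cong (a₁ + a₀) (Δ*-↭ (series Y₁) reversal) ⟩
    shift (a₁ + a₀) (Δ a₄ (Δ a₃ (Δ a₂ (Δ a₁ (series Y₁)))))
      ≈⟨ shift-cong (a₁ + a₀) peel ⟩
    shift (a₁ + a₀) (G (1 + k) (1 + k)) ∎
    where
    open SetoidReasoning (ℤ →-setoid ℤ)
    Y₄ Y₃ Y₂ Y₁ : FPS
    Y₄ = geomInv a₄ ⊛ CP30 k
    Y₃ = geomInv a₃ ⊛ Y₄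
    Y₂ = geomInv a₂ ⊛ Y₃
    Y₁ = geomInv a₁ ⊛ Y₂
    reversal : L ↭ a₄ ∷ a₃ ∷ a₂ ∷ a₁ ∷ []
    reversal = ↭.trans (↭.swap a₂ a₁ ↭.refl) (↭-sym (↭-reverse (a₁ ∷ a₂ ∷ a₃ ∷ a₄ ∷ [])))
    peel : Δ a₄ (Δ a₃ (Δ a₂ (Δ a₁ (series Y₁)))) ≗ G (1 + k) (1 + k)
    peel x = trans (Δ-cong a₄ (Δ-cong a₃ (Δ-cong a₂ (Δ-geomInv⊛ a₁ Y₂ z<s))) x)
            (trans (Δ-cong a₄ (Δ-cong a₃ (Δ-geomInv⊛ a₂ Y₃ z<s)) x)
            (trans (Δ-cong a₄ (Δ-geomInv⊛ a₃ Y₄ z<s) x)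
            (trans (Δ-geomInv⊛ a₄ (CP30 k) z<s x) (series-CP30₀ x))))

  recurrence : series (CP30 (2 + k)) ≗ series (X ⊖ Y)
  recurrence = Δ*-injective L _ _ (z<s ∷ z<s ∷ z<s ∷ z<s ∷ []) (Causal-series (CP30 (2 + k))) (Causal-series (X ⊖ Y)) (begin
    Δ* L (series (CP30 (2 + k)))
      ≈⟨ Δ*-cong L series-CP30₂ ⟩
    Δ* L (G (3 + k) (3 + k))
      ≈⟨ core ⟩
    Q ⊞ shift a₁ Q ⊞ shift a₂ Q ⊟ shift (a₁ + a₀) (G (1 + k) (1 + k))
      ≈⟨ ⊟-cong Δ*-X Δ*-Y ⟨
    Δ* L (series X) ⊟ Δ* L (series Y)
      ≈⟨ Δ*-⊟ L (series X) (series Y) ⟨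
    Δ* L (series X ⊟ series Y)
      ≈⟨ Δ*-cong L (series-⊖ X Y) ⟨
    Δ* L (series (X ⊖ Y)) ∎)
    where open SetoidReasoning (ℤ →-setoid ℤ)

recurrence-with-exponents : ∀ k {e₁ e₂ e₃ e₄ c} →
  e₁ ≡ Elimination.a₁ k → e₂ ≡ Elimination.a₂ k → e₃ ≡ Elimination.a₃ k → e₄ ≡ Elimination.a₄ k →
  c ≡ Elimination.a₁ k + Elimination.a₀ k →
  series (CP30 (2 + k)) ≗
  series ((geomInv e₃ ⊛ (geomInv e₄ ⊛ (((one ⊕ qpow e₁) ⊕ qpow e₂) ⊛ CP30 (1 + k))))
          ⊖ (qpow c ⊛ (geomInv e₁ ⊛ (geomInv e₂ ⊛ (geomInv e₃ ⊛ (geomInv e₄ ⊛ CP30 k))))))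
recurrence-with-exponents k refl refl refl refl refl = Elimination.recurrence k

theorem4p4 : (n : ℕ) → 2 ≤ n → (m : ℕ) →
    CP30 n m ≡
      ((geomInv (2 * n ∸ 1) ⊛ (geomInv (2 * n) ⊛
          (((one ⊕ qpow (2 * n ∸ 3)) ⊕ qpow (2 * n ∸ 2)) ⊛ CP30 (n ∸ 1))))
       ⊖ (qpow (4 * n ∸ 7) ⊛ (geomInv (2 * n ∸ 3) ⊛ (geomInv (2 * n ∸ 2) ⊛
          (geomInv (2 * n ∸ 1) ⊛ (geomInv (2 * n) ⊛ CP30 (n ∸ 2))))))) m
theorem4p4 (suc (suc k)) (s≤s (s≤s z≤n)) m =
  recurrence-with-exponents k (cong (_∸ 3) (2*[2+k] k)) (cong (_∸ 2) (2*[2+k] k)) (cong (_∸ 1) (2*[2+k] k))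
                              (2*[2+k] k) (cong (_∸ 7) (4*[2+k] k)) (+ m)
  where
  2*[2+k] : ∀ k → 2 * (2 + k) ≡ 4 + (k + k)
  2*[2+k] = solve-∀
  4*[2+k] : ∀ k → 4 * (2 + k) ≡ 8 + ((k + k) + (k + k))
  4*[2+k] = solve-∀
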